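{- There exists a $(\frac{q-1}{2},6;6)$ Heffter space for every prime $q\equiv 13 \pmod{24}$ with $109\le q\le 8000$.
   Context: A $(v_r,b_k)$ configuration is a point-block incidence structure $(V,\mathcal{B})$ with $v$ points and $b$ blocks, each block a $k$-subset of $V$, any two distinct points in at most one common block, and every point in exactly $r$ blocks; it is resolvable if $\mathcal{B}$ partitions into $r$ parallel classes, each of which is a partition of $V$. A half-set of an abelian group $G$ is a subset $V$ with $V$ and $-V$ partitioning $G\setminus\{0\}$. A $(v,k;r)$ Heffter space over an abelian group $G$ is a resolvable $(v_r,b_k)$ configuration whose point set is a half-set of $G$ and whose blocks are all zero-sum in $G$. -}

module Defs where

open import Data.Nat using (ℕ; _∸_; _≡ᵇ_)
open import Data.Nat.Divisibility using (_∣_)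
open import Data.Fin using (Fin; toℕ)
open import Data.List using (List; length; map)
open import Data.Nat.ListAction using (sum)
open import Data.List.Membership.Propositional using (_∈_)
open import Data.List.Relation.Unary.All using (All)
open import Data.List.Relation.Unary.Any using (Any)
open import Data.List.Relation.Unary.Unique.Propositional using (Unique)
open import Data.Product using (Σ; ∃; _×_)
open import Data.Sum using (_⊎_)
open import Relation.Binary.PropositionalEquality using (_≡_; _≢_)
open import Relation.Nullary using (¬_)

-- The cyclic group ℤ_q is represented by Fin q, with x ↦ toℕ x (mod q).
-- Membership in a list of group elements, addressed by the natural-number representative.
_∈ₙ_ : {q : ℕ} → ℕ → List (Fin q) → Set
n ∈ₙ L = Any (λ y → toℕ y ≡ n) L

-- V is a half-set of ℤ_q: V and -V partition ℤ_q ∖ {0}.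
-- (For x ≠ 0, the negative of x in ℤ_q has representative q ∸ toℕ x.)
record IsHalfSet (q : ℕ) (V : List (Fin q)) : Set where
  field
    unique    : Unique V
    noZero    : ∀ x → x ∈ V → toℕ x ≢ 0
    covers    : ∀ (x : Fin q) → toℕ x ≢ 0 → (x ∈ V) ⊎ ((q ∸ toℕ x) ∈ₙ V)
    disjoint  : ∀ (x : Fin q) → x ∈ V → ¬ ((q ∸ toℕ x) ∈ₙ V)

-- Blocks are given already organised into the r parallel classes of the resolution:
-- class i is the list  classes i  of blocks; a block is identified by its index
-- (i , j) with j < length (classes i), so the block family is a multiset and
-- repeated blocks are excluded by the "at most one common block" condition.
record HeffterSpace (q v k r : ℕ) : Set where
  field
    V        : List (Fin q)
    numPts   : length V ≡ v
    halfSet  : IsHalfSet q V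
    classes  : Fin r → List (List (Fin q))

  BlockIx : Set
  BlockIx = Σ (Fin r) (λ i → Fin (length (classes i)))

  block : BlockIx → List (Fin q)
  block (i Data.Product., j) = Data.List.lookup (classes i) j

  field
    blockSize    : ∀ β → length (block β) ≡ k
    blockUnique  : ∀ β → Unique (block β)
    blockInV     : ∀ β → All (_∈ V) (block β)
    zeroSum      : ∀ β → q ∣ sum (map toℕ (block β))
    classCovers  : ∀ (i : Fin r) x → x ∈ V →
                     ∃ λ (j : Fin (length (classes i))) → x ∈ Data.List.lookup (classes i) j
    classDisj    : ∀ (i : Fin r) x (j j′ : Fin (length (classes i))) →
                     x ∈ Data.List.lookup (classes i) j →
                     x ∈ Data.List.lookup (classes i) j′ → j ≡ j′
    linear       : ∀ x y → x ≢ y → ∀ β γ →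
                     x ∈ block β → y ∈ block β → x ∈ block γ → y ∈ block γ → β ≡ γ

{-# OPTIONS --safe #-}
-- Write q = 12n + 1 and let h have order n modulo q. Six residues g₀, …, g₅ are chosen so that
-- the cosets ±gₛ⟨h⟩ are exactly the twelve cosets of ⟨h⟩ in ℤ_q^*; then V = ⋃ₛ gₛ⟨h⟩ is a
-- half-set. For each of six parallel classes pick a zero-sum base block {gₛ h^(E i s)}ₛ, taking one
-- point from each coset, and let the class consist of its n multiples by the powers of h.
-- Multiplying by h^c keeps the sum zero and permutes the points within each coset, so every class
-- partitions V. Two distinct points of a block lie in different cosets, and the blocks of two
-- different classes through them would force E i s − E j s ≡ E i t − E j t (mod n); the base
-- blocks are chosen so that this never happens. For each of the 123 primes q ≡ 13 (mod 24) in
-- [109, 8000], data (n, h, g, E) with these properties were found by computer and are verified by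
-- evaluation; every other q ≡ 13 (mod 24) in that range has a divisor below 109.
module Submission where

open import Defs
open import Data.Nat using (ℕ; _≤_; _∸_; _/_; _%_)
open import Data.Nat.Primality using (Prime)
open import Relation.Binary.PropositionalEquality using (_≡_)

open import Level using (0ℓ)
open import Function using (_∘_; id)
open import Function.Bundles using (module Equivalence)
open import Data.Empty using (⊥-elim)
open import Data.Bool using (Bool; true; false; T; _∧_; _∨_; not)
open import Data.Bool.Properties using (T-∧; T-∨; T-≡)
open import Data.Bool.ListAction using (all; any)
open import Data.Product using (∃; ∃₂; _×_; _,_; proj₁; proj₂; uncurry)
open import Data.Product.Properties using (,-injective)
open import Data.Sum using (_⊎_; inj₁; inj₂; [_,_]′)
open import Data.Nat using (NonZero; suc; _+_; _*_; _^_; _<_; s≤s; _≡ᵇ_)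
open import Data.Nat.Properties
  using ( +-assoc; +-comm; +-identityʳ; *-assoc; *-comm; *-identityʳ; *-zeroʳ; *-distribˡ-+
        ; ^-distribˡ-+-*; ^-*-assoc; ^-zeroˡ; ≡ᵇ⇒≡; ≡⇒≡ᵇ; ≤-trans; <⇒≤; <⇒≢
        ; m∸n+n≡m; m∸[m∸n]≡n; m+[n∸m]≡n; ∸-monoˡ-≤; +-commutativeSemigroup; ≤-decTotalOrder )
open import Algebra.Properties.CommutativeSemigroup +-commutativeSemigroup
  using () renaming (interchange to +-interchange)
open import Data.Nat.DivMod
  using ( m%n<n; m%n≤n; m%n%n≡m%n; n%n≡0; m*n%n≡0; m<n⇒m%n≡m; m≡m%n+[m/n]*n
        ; m*n/n≡m; %-distribˡ-+; %-distribˡ-* )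
open import Data.Nat.Divisibility using (_∣_; m%n≡0⇒n∣m; n∣m⇒m%n≡0)
open import Data.Nat.ListAction using (sum)
open import Data.Nat.Primality using (prime⇒irreducible)
open import Data.Fin using (Fin; toℕ; fromℕ<)
open import Data.Fin.Properties using (toℕ-fromℕ<; toℕ-injective; toℕ<n) renaming (_≟_ to _≟ᶠ_)
open import Data.Vec using (Vec; []; _∷_)
import Data.Vec as Vec
open import Data.List
  using ( List; []; _∷_; _++_; map; length; lookup; concatMap; iterate; applyUpTo; applyDownFrom
        ; upTo; downFrom; allFin; cartesianProduct )
open import Data.List.Properties
  using ( map-++; map-∘; map-cong; map-upTo; concatMap-cong; length-map; length-++
        ; length-applyUpTo; length-tabulate; lookup-applyUpTo )
open import Data.List.Membership.Propositional using (_∈_; find; lose)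
open import Data.List.Membership.Propositional.Properties
  using ( ∈-map⁺; ∈-map⁻; ∈-++⁺ˡ; ∈-++⁺ʳ; ∈-++⁻; ∈-allFin; ∈-upTo⁺; ∈-applyUpTo⁺; ∈-applyUpTo⁻
        ; ∈-applyDownFrom⁺; ∈-downFrom⁻; ∈-cartesianProduct⁺ )
open import Data.List.Relation.Unary.Any using (Any; here; there; satisfied)
open import Data.List.Relation.Unary.Any.Properties using (any⁻)
open import Data.List.Relation.Unary.All using (All; universal) renaming (lookup to All-lookup)
open import Data.List.Relation.Unary.All.Properties using (all⁺; ++⁻ˡ) renaming (map⁺ to All-map⁺)
open import Data.List.Relation.Unary.AllPairs using ([]; _∷_)
open import Data.List.Relation.Unary.Unique.Propositional using (Unique)
import Data.List.Relation.Unary.Unique.Propositional.Properties as Unique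
open import Data.List.Relation.Binary.Disjoint.Propositional using (Disjoint)
open import Data.List.Relation.Binary.Permutation.Propositional using (_↭_; ↭-sym; ↭⇒↭ₛ)
open import Data.List.Relation.Binary.Permutation.Propositional.Properties using (∈-resp-↭; ↭-length)
open import Data.List.Sort.MergeSort ≤-decTotalOrder using (sort)
open import Data.List.Sort.MergeSort.Properties ≤-decTotalOrder using (sort-↭)
open import Relation.Binary.Bundles using (Setoid)
import Relation.Binary.Reasoning.Setoid as SetoidReasoning
open import Relation.Binary.PropositionalEquality
  using (_≢_; refl; sym; trans; cong; cong₂; subst; setoid; module ≡-Reasoning)
open import Data.List.Relation.Binary.Permutation.Setoid.Properties (setoid ℕ) using (Unique-resp-↭)
open import Relation.Nullary using (¬_; yes; no)

-- Congruences modulo m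

infix 4 _≡_mod_
record _≡_mod_ (a b m : ℕ) .{{_ : NonZero m}} : Set where
  constructor congruent
  field %-≡ : a % m ≡ b % m
open _≡_mod_

module _ {m : ℕ} .{{_ : NonZero m}} where

  ≡-mod-refl : ∀ {a} → a ≡ a mod m
  ≡-mod-refl = congruent refl

  ≡-mod-sym : ∀ {a b} → a ≡ b mod m → b ≡ a mod m
  ≡-mod-sym (congruent p) = congruent (sym p)

  ≡-mod-trans : ∀ {a b c} → a ≡ b mod m → b ≡ c mod m → a ≡ c mod m
  ≡-mod-trans (congruent p) (congruent q) = congruent (trans p q)

≡-mod-setoid : (m : ℕ) .{{_ : NonZero m}} → Setoid 0ℓ 0ℓ
≡-mod-setoid m = record
  { Carrier       = ℕ
  ; _≈_           = λ a b → a ≡ b mod m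
  ; isEquivalence = record { refl = ≡-mod-refl ; sym = ≡-mod-sym ; trans = ≡-mod-trans }
  }

module ≡-mod-Reasoning (m : ℕ) .{{_ : NonZero m}} = SetoidReasoning (≡-mod-setoid m)

module _ {m : ℕ} .{{_ : NonZero m}} where

  %-≡-mod : ∀ a → a % m ≡ a mod m
  %-≡-mod a = congruent (m%n%n≡m%n a m)

  ≡-mod⇒≡ : ∀ {a b} → a < m → b < m → a ≡ b mod m → a ≡ b
  ≡-mod⇒≡ a<m b<m (congruent p) = trans (sym (m<n⇒m%n≡m a<m)) (trans p (m<n⇒m%n≡m b<m))

  ∣⇒≡0-mod : ∀ {a} → m ∣ a → a ≡ 0 mod m
  ∣⇒≡0-mod {a} m∣a = congruent (trans (n∣m⇒m%n≡0 a m m∣a) (sym (m*n%n≡0 0 m)))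

  ≡0-mod⇒∣ : ∀ {a} → a ≡ 0 mod m → m ∣ a
  ≡0-mod⇒∣ {a} (congruent p) = m%n≡0⇒n∣m a m (trans p (m*n%n≡0 0 m))

  m≡0-mod : m ≡ 0 mod m
  m≡0-mod = congruent (trans (n%n≡0 m) (sym (m*n%n≡0 0 m)))

  +-cong-mod : ∀ {a b c d} → a ≡ b mod m → c ≡ d mod m → a + c ≡ b + d mod m
  +-cong-mod {a} {b} {c} {d} (congruent p) (congruent q) = congruent (begin
    (a + c) % m               ≡⟨ %-distribˡ-+ a c m ⟩
    (a % m + c % m) % m       ≡⟨ cong₂ (λ x y → (x + y) % m) p q ⟩
    (b % m + d % m) % m       ≡⟨ %-distribˡ-+ b d m ⟨
    (b + d) % m               ∎)
    where open ≡-Reasoning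

  *-cong-mod : ∀ {a b c d} → a ≡ b mod m → c ≡ d mod m → a * c ≡ b * d mod m
  *-cong-mod {a} {b} {c} {d} (congruent p) (congruent q) = congruent (begin
    (a * c) % m               ≡⟨ %-distribˡ-* a c m ⟩
    (a % m * (c % m)) % m     ≡⟨ cong₂ (λ x y → (x * y) % m) p q ⟩
    (b % m * (d % m)) % m     ≡⟨ %-distribˡ-* b d m ⟨
    (b * d) % m               ∎)
    where open ≡-Reasoning

  ^-congˡ-mod : ∀ {a b} → a ≡ b mod m → ∀ e → a ^ e ≡ b ^ e mod m
  ^-congˡ-mod a≡b 0       = ≡-mod-refl
  ^-congˡ-mod a≡b (suc e) = *-cong-mod a≡b (^-congˡ-mod a≡b e)

  m∸a%m+a≡0-mod : ∀ a → m ∸ a % m + a ≡ 0 mod m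
  m∸a%m+a≡0-mod a = begin
    m ∸ a % m + a        ≈⟨ +-cong-mod (≡-mod-refl {a = m ∸ a % m}) (%-≡-mod a) ⟨
    m ∸ a % m + a % m    ≡⟨ m∸n+n≡m (m%n≤n a m) ⟩
    m                    ≈⟨ m≡0-mod ⟩
    0                    ∎
    where open ≡-mod-Reasoning m

  +-cancelˡ-mod : ∀ k {a b} → k + a ≡ k + b mod m → a ≡ b mod m
  +-cancelˡ-mod k {a} {b} k+a≡k+b = begin
    a                    ≈⟨ +-cong-mod (m∸a%m+a≡0-mod k) (≡-mod-refl {a = a}) ⟨
    (-k + k) + a         ≡⟨ +-assoc -k k a ⟩
    -k + (k + a)         ≈⟨ +-cong-mod (≡-mod-refl {a = -k}) k+a≡k+b ⟩
    -k + (k + b)         ≡⟨ +-assoc -k k b ⟨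
    (-k + k) + b         ≈⟨ +-cong-mod (m∸a%m+a≡0-mod k) (≡-mod-refl {a = b}) ⟩
    b                    ∎
    where
    open ≡-mod-Reasoning m
    -k = m ∸ k % m

  +-cancelʳ-mod : ∀ k {a b} → a + k ≡ b + k mod m → a ≡ b mod m
  +-cancelʳ-mod k {a} {b} (congruent p) = +-cancelˡ-mod k (congruent (begin
    (k + a) % m   ≡⟨ cong (_% m) (+-comm k a) ⟩
    (a + k) % m   ≡⟨ p ⟩
    (b + k) % m   ≡⟨ cong (_% m) (+-comm b k) ⟩
    (k + b) % m   ∎))
    where open ≡-Reasoning

  sum-cong-mod : ∀ {A : Set} {f g : A → ℕ} → (∀ x → f x ≡ g x mod m) →
                 ∀ xs → sum (map f xs) ≡ sum (map g xs) mod m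
  sum-cong-mod f≡g []       = ≡-mod-refl
  sum-cong-mod f≡g (x ∷ xs) = +-cong-mod (f≡g x) (sum-cong-mod f≡g xs)

^-%-periodic : ∀ {q n h} .{{_ : NonZero q}} .{{_ : NonZero n}} →
               h ^ n ≡ 1 mod q → ∀ a → h ^ (a % n) ≡ h ^ a mod q
^-%-periodic {q} {n} {h} h^n≡1 a = begin
  h ^ (a % n)                       ≡⟨ *-identityʳ _ ⟨
  h ^ (a % n) * 1                   ≡⟨ cong (h ^ (a % n) *_) (^-zeroˡ (a / n)) ⟨
  h ^ (a % n) * 1 ^ (a / n)         ≈⟨ *-cong-mod (≡-mod-refl {a = h ^ (a % n)}) 1^a/n≡h^n^a/n ⟩
  h ^ (a % n) * (h ^ n) ^ (a / n)   ≡⟨ cong (h ^ (a % n) *_) (^-*-assoc h n (a / n)) ⟩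
  h ^ (a % n) * h ^ (n * (a / n))   ≡⟨ ^-distribˡ-+-* h (a % n) (n * (a / n)) ⟨
  h ^ (a % n + n * (a / n))         ≡⟨ cong (λ e → h ^ (a % n + e)) (*-comm n (a / n)) ⟩
  h ^ (a % n + a / n * n)           ≡⟨ cong (h ^_) (m≡m%n+[m/n]*n a n) ⟨
  h ^ a                             ∎
  where
  open ≡-mod-Reasoning q
  1^a/n≡h^n^a/n = ≡-mod-sym (^-congˡ-mod h^n≡1 (a / n))

module _ {A : Set} where

  Unique-++⁻ˡ : ∀ {xs ys : List A} → Unique (xs ++ ys) → Unique xs
  Unique-++⁻ˡ {[]}     _          = []
  Unique-++⁻ˡ {x ∷ xs} (x∉ ∷ xs!) = ++⁻ˡ xs x∉ ∷ Unique-++⁻ˡ xs!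

  Unique-++⇒Disjoint : ∀ {xs ys : List A} → Unique (xs ++ ys) → Disjoint xs ys
  Unique-++⇒Disjoint {x ∷ xs} (x∉ ∷ _) (here refl , v∈ys) = All-lookup x∉ (∈-++⁺ʳ xs v∈ys) refl
  Unique-++⇒Disjoint {x ∷ xs} (_ ∷ xs!) (there v∈xs , v∈ys) =
    Unique-++⇒Disjoint xs! (v∈xs , v∈ys)

  Unique-map⇒injectiveOn : ∀ {B : Set} {f : A → B} {xs x y} →
                           Unique (map f xs) → x ∈ xs → y ∈ xs → f x ≡ f y → x ≡ y
  Unique-map⇒injectiveOn _ (here refl) (here refl) _ = refl
  Unique-map⇒injectiveOn {f = f} (fx∉ ∷ _) (here refl) (there y∈) fx≡fy =
    ⊥-elim (All-lookup fx∉ (∈-map⁺ f y∈) fx≡fy)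
  Unique-map⇒injectiveOn {f = f} (fy∉ ∷ _) (there x∈) (here refl) fx≡fy =
    ⊥-elim (All-lookup fy∉ (∈-map⁺ f x∈) (sym fx≡fy))
  Unique-map⇒injectiveOn (_ ∷ fxs!) (there x∈) (there y∈) fx≡fy =
    Unique-map⇒injectiveOn fxs! x∈ y∈ fx≡fy

  iterate≡applyUpTo : ∀ {f : A → A} (g : ℕ → A) → (∀ a → f (g a) ≡ g (suc a)) →
                      ∀ k → iterate f (g 0) k ≡ applyUpTo g k
  iterate≡applyUpTo         g step 0       = refl
  iterate≡applyUpTo {f = f} g step (suc k) = cong (g 0 ∷_) (begin
    iterate f (f (g 0)) k   ≡⟨ cong (λ x → iterate f x k) (step 0) ⟩
    iterate f (g 1) k       ≡⟨ iterate≡applyUpTo (g ∘ suc) (step ∘ suc) k ⟩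
    applyUpTo (g ∘ suc) k   ∎)
    where open ≡-Reasoning

  sum-map-*ˡ : ∀ c (f : A → ℕ) xs → sum (map (λ x → c * f x) xs) ≡ c * sum (map f xs)
  sum-map-*ˡ c f []       = sym (*-zeroʳ c)
  sum-map-*ˡ c f (x ∷ xs) = trans (cong (c * f x +_) (sum-map-*ˡ c f xs))
                                  (sym (*-distribˡ-+ c (f x) (sum (map f xs))))

map-uncurry-cartesianProduct : ∀ {A B C : Set} (f : A → B → C) xs ys →
  map (uncurry f) (cartesianProduct xs ys) ≡ concatMap (λ x → map (f x) ys) xs
map-uncurry-cartesianProduct f []       ys = refl
map-uncurry-cartesianProduct f (x ∷ xs) ys = begin
  map (uncurry f) (map (x ,_) ys ++ cartesianProduct xs ys)
    ≡⟨ map-++ (uncurry f) (map (x ,_) ys) _ ⟩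
  map (uncurry f) (map (x ,_) ys) ++ map (uncurry f) (cartesianProduct xs ys)
    ≡⟨ cong₂ _++_ (sym (map-∘ ys)) (map-uncurry-cartesianProduct f xs ys) ⟩
  map (f x) ys ++ concatMap (λ x → map (f x) ys) xs
    ∎
  where open ≡-Reasoning

T-∧⁻ : ∀ {a b} → T (a ∧ b) → T a × T b
T-∧⁻ = Equivalence.to T-∧

T-∨⁻ : ∀ {a b} → T (a ∨ b) → T a ⊎ T b
T-∨⁻ = Equivalence.to T-∨

T-not⁻ : ∀ {a} → T (not a) → ¬ T a
T-not⁻ {false} _ ()

T-all-allFin : ∀ {k} {p : Fin k → Bool} → T (all p (allFin k)) → ∀ i → T (p i)
T-all-allFin {p = p} ok i = All-lookup (all⁺ p (allFin _) ok) (∈-allFin i)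

_≡ᵇ-list_ : List ℕ → List ℕ → Bool
[]       ≡ᵇ-list []       = true
(x ∷ xs) ≡ᵇ-list (y ∷ ys) = (x ≡ᵇ y) ∧ (xs ≡ᵇ-list ys)
_        ≡ᵇ-list _        = false

≡ᵇ-list⇒≡ : ∀ xs ys → T (xs ≡ᵇ-list ys) → xs ≡ ys
≡ᵇ-list⇒≡ []       []       _  = refl
≡ᵇ-list⇒≡ (x ∷ xs) (y ∷ ys) ok =
  let x≡y , xs≡ys = T-∧⁻ ok in cong₂ _∷_ (≡ᵇ⇒≡ x y x≡y) (≡ᵇ-list⇒≡ xs ys xs≡ys)

-- Half-sets of ℤ_q

nonzeroResidues : ℕ → List ℕ
nonzeroResidues q = applyUpTo suc (q ∸ 1)

∈-nonzeroResidues⁺ : ∀ {u q} → u ≢ 0 → u < q → u ∈ nonzeroResidues q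
∈-nonzeroResidues⁺ {0}     u≢0 _           = ⊥-elim (u≢0 refl)
∈-nonzeroResidues⁺ {suc i} _   (s≤s i<q-1) = ∈-applyUpTo⁺ suc i<q-1

∈-nonzeroResidues⁻ : ∀ {u q} → u ∈ nonzeroResidues q → u ≢ 0
∈-nonzeroResidues⁻ u∈ with _ , _ , refl ← ∈-applyUpTo⁻ suc u∈ = λ ()

nonzeroResidues-unique : ∀ q → Unique (nonzeroResidues q)
nonzeroResidues-unique q = Unique.applyUpTo⁺₁ suc (q ∸ 1) (λ i<j _ → <⇒≢ (s≤s i<j))

signedResidues : ∀ {q} → List (Fin q) → List ℕ
signedResidues {q} V = map toℕ V ++ map (q ∸_) (map toℕ V)

module _ {q : ℕ} {V : List (Fin q)} (±V↭ : signedResidues V ↭ nonzeroResidues q) where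

  private
    ±V-unique : Unique (signedResidues V)
    ±V-unique = Unique-resp-↭ (↭⇒↭ₛ (↭-sym ±V↭)) (nonzeroResidues-unique q)

    ∈-V⁺ : ∀ {x} → toℕ x ∈ map toℕ V → x ∈ V
    ∈-V⁺ x∈ with y , y∈V , x≡y ← ∈-map⁻ toℕ x∈ =
      subst (_∈ V) (sym (toℕ-injective x≡y)) y∈V

    q∸q∸x≡x : ∀ (x : Fin q) → q ∸ (q ∸ toℕ x) ≡ toℕ x
    q∸q∸x≡x x = m∸[m∸n]≡n (<⇒≤ (toℕ<n x))

  isHalfSet : IsHalfSet q V
  isHalfSet = record
    { unique   = Unique.map⁻ (Unique-++⁻ˡ ±V-unique)
    ; noZero   = λ x x∈V →
                   ∈-nonzeroResidues⁻ {q = q} (∈-resp-↭ ±V↭ (∈-++⁺ˡ (∈-map⁺ toℕ x∈V)))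
    ; covers   = covers
    ; disjoint = disjoint
    }
    where
    covers : ∀ (x : Fin q) → toℕ x ≢ 0 → (x ∈ V) ⊎ ((q ∸ toℕ x) ∈ₙ V)
    covers x x≢0
      with ∈-++⁻ (map toℕ V) (∈-resp-↭ (↭-sym ±V↭) (∈-nonzeroResidues⁺ x≢0 (toℕ<n x)))
    ... | inj₁ x∈ = inj₁ (∈-V⁺ x∈)
    ... | inj₂ x∈
      with u , u∈ , x≡-u ← ∈-map⁻ (q ∸_) x∈
      with y , y∈V , refl ← ∈-map⁻ toℕ u∈ =
        inj₂ (lose y∈V (sym (trans (cong (q ∸_) x≡-u) (q∸q∸x≡x y))))

    disjoint : ∀ (x : Fin q) → x ∈ V → ¬ ((q ∸ toℕ x) ∈ₙ V)
    disjoint x x∈V -x∈ with y , y∈V , y≡-x ← find -x∈ =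
      Unique-++⇒Disjoint ±V-unique (∈-map⁺ toℕ x∈V , subst (_∈ _) -y≡x (∈-map⁺ (q ∸_) y∈))
      where
      y∈  = ∈-map⁺ toℕ y∈V
      -y≡x = trans (cong (q ∸_) y≡-x) (q∸q∸x≡x x)

  length-halfSet : length V ≡ (q ∸ 1) / 2
  length-halfSet = begin
    length V                              ≡⟨ m*n/n≡m (length V) 2 ⟨
    length V * 2 / 2                      ≡⟨ cong (_/ 2) (begin
      length V * 2                          ≡⟨ *-comm (length V) 2 ⟩
      length V + (length V + 0)             ≡⟨ cong (length V +_) (+-identityʳ (length V)) ⟩
      length V + length V                   ≡⟨ cong₂ _+_ (length-map toℕ V) length-rs ⟨
      length rs + length (map (q ∸_) rs)    ≡⟨ length-++ rs ⟨
      length (signedResidues V)             ≡⟨ ↭-length ±V↭ ⟩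
      length (nonzeroResidues q)            ≡⟨ length-applyUpTo suc (q ∸ 1) ⟩
      q ∸ 1                                 ∎) ⟩
    (q ∸ 1) / 2                           ∎
    where
    open ≡-Reasoning
    rs = map toℕ V
    length-rs = trans (length-map (q ∸_) rs) (length-map toℕ V)

-- Heffter spaces from the cosets of ⟨h⟩

module CyclotomicConstruction (q n h : ℕ) .{{_ : NonZero q}} .{{_ : NonZero n}}
                              {k r : ℕ} (g : Fin k → ℕ) (E : Fin r → Fin k → ℕ) where

  residue : Fin k → ℕ → ℕ
  residue s a = g s * h ^ a % q

  point : Fin k → ℕ → Fin q
  point s a = fromℕ< (m%n<n (g s * h ^ a) q)

  points : List (Fin q)
  points = map (uncurry point) (cartesianProduct (allFin k) (upTo n))

  block : Fin r → ℕ → List (Fin q)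
  block i c = map (λ s → point s (E i s + c)) (allFin k)

  parallelClass : Fin r → List (List (Fin q))
  parallelClass i = applyUpTo (block i) n

  baseBlockSum : Fin r → ℕ
  baseBlockSum i = sum (map (λ s → g s * h ^ E i s) (allFin k))

  record Conditions : Set where
    field
      h^n≡1                : h ^ n ≡ 1 mod q
      baseBlock-zeroSum    : ∀ i → q ∣ baseBlockSum i
      -- E i s − E j s ≢ E i t − E j t (mod n), with both sides moved to avoid subtraction
      differences-distinct : ∀ i j s t → i ≢ j → s ≢ t → ¬ (E i s + E j t ≡ E j s + E i t mod n)

  differenceCheck : Fin r → Fin r → Fin k → Fin k → Bool
  differenceCheck i j s t =
    (toℕ i ≡ᵇ toℕ j) ∨ (toℕ s ≡ᵇ toℕ t) ∨ not ((E i s + E j t) % n ≡ᵇ (E j s + E i t) % n)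

  orderCheck zeroSumCheck differencesCheck checkConditions : Bool
  orderCheck       = h ^ n % q ≡ᵇ 1 % q
  zeroSumCheck     = all (λ i → baseBlockSum i % q ≡ᵇ 0) (allFin r)
  differencesCheck = all (λ i → all (λ j → all (λ s → all (differenceCheck i j s)
                       (allFin k)) (allFin k)) (allFin r)) (allFin r)
  checkConditions  = orderCheck ∧ zeroSumCheck ∧ differencesCheck

  checkConditions-sound : T checkConditions → Conditions
  checkConditions-sound ok = record
    { h^n≡1                = congruent (≡ᵇ⇒≡ _ _ order-ok)
    ; baseBlock-zeroSum    = λ i → m%n≡0⇒n∣m _ q (≡ᵇ⇒≡ _ _ (T-all-allFin zeroSum-ok i))
    ; differences-distinct = λ i j s t → differenceCheck-sound
        (T-all-allFin (T-all-allFin (T-all-allFin (T-all-allFin differences-ok i) j) s) t)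
    }
    where
    order-ok       = proj₁ (T-∧⁻ {orderCheck} ok)
    zeroSum-ok     = proj₁ (T-∧⁻ {zeroSumCheck} (proj₂ (T-∧⁻ {orderCheck} ok)))
    differences-ok = proj₂ (T-∧⁻ {zeroSumCheck} (proj₂ (T-∧⁻ {orderCheck} ok)))

    differenceCheck-sound : ∀ {i j s t} → T (differenceCheck i j s t) →
                            i ≢ j → s ≢ t → ¬ (E i s + E j t ≡ E j s + E i t mod n)
    differenceCheck-sound ok i≢j s≢t (congruent eq) with T-∨⁻ ok
    ... | inj₁ i≡j = i≢j (toℕ-injective (≡ᵇ⇒≡ _ _ i≡j))
    ... | inj₂ ok′ with T-∨⁻ ok′
    ... | inj₁ s≡t = s≢t (toℕ-injective (≡ᵇ⇒≡ _ _ s≡t))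
    ... | inj₂ ≢-ok = T-not⁻ ≢-ok (≡⇒≡ᵇ _ _ eq)

  toℕ-point : ∀ s a → toℕ (point s a) ≡ residue s a
  toℕ-point s a = toℕ-fromℕ< _

  residues-iterate : map toℕ points ≡
                     concatMap (λ s → iterate (λ x → x * h % q) (residue s 0) n) (allFin k)
  residues-iterate = begin
    map toℕ (map (uncurry point) pairs)
      ≡⟨ map-∘ pairs ⟨
    map (toℕ ∘ uncurry point) pairs
      ≡⟨ map-cong (λ (s , a) → toℕ-point s a) pairs ⟩
    map (uncurry residue) pairs
      ≡⟨ map-uncurry-cartesianProduct residue (allFin k) (upTo n) ⟩
    concatMap (λ s → map (residue s) (upTo n)) (allFin k)
      ≡⟨ concatMap-cong (λ s → map-upTo (residue s) n) (allFin k) ⟩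
    concatMap (λ s → applyUpTo (residue s) n) (allFin k)
      ≡⟨ concatMap-cong (λ s → iterate≡applyUpTo (residue s) (step s) n) (allFin k) ⟨
    concatMap (λ s → iterate (λ x → x * h % q) (residue s 0) n) (allFin k)
      ∎
    where
    open ≡-Reasoning
    pairs = cartesianProduct (allFin k) (upTo n)
    step : ∀ s a → residue s a * h % q ≡ residue s (suc a)
    step s a = begin
      g s * h ^ a % q * h % q     ≡⟨ %-≡ (*-cong-mod (%-≡-mod (g s * h ^ a)) (≡-mod-refl {a = h})) ⟩
      g s * h ^ a * h % q         ≡⟨ cong (_% q) (*-assoc (g s) (h ^ a) h) ⟩
      g s * (h ^ a * h) % q       ≡⟨ cong (λ x → g s * x % q) (*-comm (h ^ a) h) ⟩
      g s * h ^ suc a % q         ∎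

  module _ (±points↭ : signedResidues points ↭ nonzeroResidues q) (conditions : Conditions) where
    open Conditions conditions

    point-% : ∀ s a → point s (a % n) ≡ point s a
    point-% s a = toℕ-injective (begin
      toℕ (point s (a % n))   ≡⟨ toℕ-point s (a % n) ⟩
      g s * h ^ (a % n) % q   ≡⟨ %-≡ (*-cong-mod (≡-mod-refl {a = g s}) (^-%-periodic h^n≡1 a)) ⟩
      g s * h ^ a % q         ≡⟨ toℕ-point s a ⟨
      toℕ (point s a)         ∎)
      where open ≡-Reasoning

    point-cong : ∀ s {a b} → a ≡ b mod n → point s a ≡ point s b
    point-cong s {a} {b} (congruent a≡b) =
      trans (sym (point-% s a)) (trans (cong (point s) a≡b) (point-% s b))

    ∈-points⁺ : ∀ s a → point s a ∈ points
    ∈-points⁺ s a = subst (_∈ points) (point-% s a)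
      (∈-map⁺ (uncurry point) (∈-cartesianProduct⁺ (∈-allFin s) (∈-upTo⁺ (m%n<n a n))))

    ∈-points⁻ : ∀ {x} → x ∈ points → ∃₂ λ s a → x ≡ point s a
    ∈-points⁻ x∈ with (s , a) , _ , x≡ ← ∈-map⁻ (uncurry point) x∈ = s , a , x≡

    point-injective : ∀ {s t} a b → point s a ≡ point t b → s ≡ t × (a ≡ b mod n)
    point-injective {s} {t} a b eq =
      let s≡t , a%n≡b%n = ,-injective (Unique-map⇒injectiveOn points-unique (index s a) (index t b) eq′)
      in  s≡t , congruent a%n≡b%n
      where
      points-unique = IsHalfSet.unique (isHalfSet {V = points} ±points↭)
      index : ∀ s a → (s , a % n) ∈ cartesianProduct (allFin k) (upTo n)
      index s a = ∈-cartesianProduct⁺ (∈-allFin s) (∈-upTo⁺ (m%n<n a n))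
      eq′ : point s (a % n) ≡ point t (b % n)
      eq′ = trans (point-% s a) (trans eq (sym (point-% t b)))

    ∈-block⁻ : ∀ {i c x} → x ∈ block i c → ∃ λ s → x ≡ point s (E i s + c)
    ∈-block⁻ x∈ with s , _ , x≡ ← ∈-map⁻ _ x∈ = s , x≡

    block-length : ∀ i c → length (block i c) ≡ k
    block-length i c = trans (length-map _ (allFin k)) (length-tabulate id)

    block-unique : ∀ i c → Unique (block i c)
    block-unique i c =
      Unique.map⁺ (λ {s} {t} → proj₁ ∘ point-injective (E i s + c) (E i t + c)) (Unique.allFin⁺ k)

    block⊆points : ∀ i c → All (_∈ points) (block i c)
    block⊆points i c = All-map⁺ (universal (λ s → ∈-points⁺ s (E i s + c)) (allFin k))

    block-sum : ∀ i c → sum (map toℕ (block i c)) ≡ h ^ c * baseBlockSum i mod q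
    block-sum i c = begin
      sum (map toℕ (block i c))                               ≡⟨ cong sum (map-∘ (allFin k)) ⟨
      sum (map (λ s → toℕ (point s (E i s + c))) (allFin k))  ≈⟨ sum-cong-mod term (allFin k) ⟩
      sum (map (λ s → h ^ c * (g s * h ^ E i s)) (allFin k))  ≡⟨ sum-map-*ˡ (h ^ c) _ (allFin k) ⟩
      h ^ c * baseBlockSum i                                  ∎
      where
      open ≡-mod-Reasoning q
      term : ∀ s → toℕ (point s (E i s + c)) ≡ h ^ c * (g s * h ^ E i s) mod q
      term s = begin
        toℕ (point s (E i s + c))       ≡⟨ toℕ-point s (E i s + c) ⟩
        g s * h ^ (E i s + c) % q       ≈⟨ %-≡-mod (g s * h ^ (E i s + c)) ⟩
        g s * h ^ (E i s + c)           ≡⟨ cong (g s *_) (^-distribˡ-+-* h (E i s) c) ⟩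
        g s * (h ^ E i s * h ^ c)       ≡⟨ *-assoc (g s) _ _ ⟨
        g s * h ^ E i s * h ^ c         ≡⟨ *-comm _ (h ^ c) ⟩
        h ^ c * (g s * h ^ E i s)       ∎

    block-zeroSum : ∀ i c → q ∣ sum (map toℕ (block i c))
    block-zeroSum i c = ≡0-mod⇒∣ (begin
      sum (map toℕ (block i c))   ≈⟨ block-sum i c ⟩
      h ^ c * baseBlockSum i      ≈⟨ *-cong-mod (≡-mod-refl {a = h ^ c}) base≡0 ⟩
      h ^ c * 0                   ≡⟨ *-zeroʳ (h ^ c) ⟩
      0                           ∎)
      where
      open ≡-mod-Reasoning q
      base≡0 = ∣⇒≡0-mod (baseBlock-zeroSum i)

    -- The block of class i through point s a is the one with c ≡ a − E i s (mod n).
    ∈-block-through : ∀ i s a → point s a ∈ block i ((a + (n ∸ E i s % n)) % n)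
    ∈-block-through i s a = subst (_∈ block i c) (point-cong s e+c≡a) (∈-map⁺ _ (∈-allFin s))
      where
      open ≡-mod-Reasoning n
      e = E i s
      c = (a + (n ∸ e % n)) % n
      e+c≡a : e + c ≡ a mod n
      e+c≡a = begin
        e + (a + (n ∸ e % n)) % n   ≈⟨ +-cong-mod (≡-mod-refl {a = e}) (%-≡-mod (a + (n ∸ e % n))) ⟩
        e + (a + (n ∸ e % n))       ≡⟨ trans (+-comm e _) (+-assoc a (n ∸ e % n) e) ⟩
        a + (n ∸ e % n + e)         ≈⟨ +-cong-mod (≡-mod-refl {a = a}) (m∸a%m+a≡0-mod e) ⟩
        a + 0                       ≡⟨ +-identityʳ a ⟩
        a                           ∎

    ∈-block-unique : ∀ {i c c′ x} → x ∈ block i c → x ∈ block i c′ → c ≡ c′ mod n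
    ∈-block-unique {i} {c} {c′} x∈ x∈′
      with s , refl ← ∈-block⁻ x∈ | s′ , x≡′ ← ∈-block⁻ x∈′
      with refl , e+c≡e+c′ ← point-injective (E i s + c) (E i s′ + c′) x≡′
      = +-cancelˡ-mod (E i s) e+c≡e+c′

    blocks-meet-once : ∀ {x y i i′ c c′} → x ≢ y →
                       x ∈ block i c → y ∈ block i c → x ∈ block i′ c′ → y ∈ block i′ c′ →
                       i ≡ i′ × (c ≡ c′ mod n)
    blocks-meet-once {i = i} {i′} {c} {c′} x≢y x∈ y∈ x∈′ y∈′
      with s , refl ← ∈-block⁻ x∈ | t , refl ← ∈-block⁻ y∈
      with s′ , x≡′ ← ∈-block⁻ x∈′ | t′ , y≡′ ← ∈-block⁻ y∈′
      with refl , Eis+c≡Ei′s+c′ ← point-injective (E i s + c) (E i′ s′ + c′) x≡′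
         | refl , Eit+c≡Ei′t+c′ ← point-injective (E i t + c) (E i′ t′ + c′) y≡′
      with i ≟ᶠ i′
    ... | yes refl = refl , +-cancelˡ-mod (E i s) Eis+c≡Ei′s+c′
    ... | no i≢i′  =
      ⊥-elim (differences-distinct i i′ s t i≢i′ s≢t (+-cancelʳ-mod (c + c′) sums))
      where
      open ≡-mod-Reasoning n
      s≢t : s ≢ t
      s≢t refl = x≢y refl
      sums : E i s + E i′ t + (c + c′) ≡ E i′ s + E i t + (c + c′) mod n
      sums = begin
        E i s + E i′ t + (c + c′)     ≡⟨ +-interchange (E i s) (E i′ t) c c′ ⟩
        (E i s + c) + (E i′ t + c′)   ≈⟨ +-cong-mod Eis+c≡Ei′s+c′ (≡-mod-sym Eit+c≡Ei′t+c′) ⟩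
        (E i′ s + c′) + (E i t + c)   ≡⟨ +-interchange (E i′ s) (E i t) c′ c ⟨
        E i′ s + E i t + (c′ + c)     ≡⟨ cong (E i′ s + E i t +_) (+-comm c′ c) ⟩
        E i′ s + E i t + (c + c′)     ∎

    ClassBlock : Set
    ClassBlock = ∃ λ i → Fin (length (parallelClass i))

    classBlock : ClassBlock → List (Fin q)
    classBlock (i , j) = lookup (parallelClass i) j

    classBlock≡block : ∀ i j → classBlock (i , j) ≡ block i (toℕ j)
    classBlock≡block i = lookup-applyUpTo (block i) n

    ∀-classBlock : ∀ (P : List (Fin q) → Set) → (∀ i c → P (block i c)) → ∀ β → P (classBlock β)
    ∀-classBlock P P-block (i , j) = subst P (sym (classBlock≡block i j)) (P-block i (toℕ j))

    ∈-classBlock⁻ : ∀ {i j x} → x ∈ classBlock (i , j) → x ∈ block i (toℕ j)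
    ∈-classBlock⁻ {i} {j} = subst (_ ∈_) (classBlock≡block i j)

    classIndex<n : ∀ i (j : Fin (length (parallelClass i))) → toℕ j < n
    classIndex<n i j = subst (toℕ j <_) (length-applyUpTo (block i) n) (toℕ<n j)

    classIndex-injective : ∀ i {j j′ : Fin (length (parallelClass i))} →
                           toℕ j ≡ toℕ j′ mod n → j ≡ j′
    classIndex-injective i {j} {j′} = toℕ-injective ∘ ≡-mod⇒≡ (classIndex<n i j) (classIndex<n i j′)

    class-covers : ∀ i {x} → x ∈ points → ∃ λ j → x ∈ classBlock (i , j)
    class-covers i x∈points with s , a , refl ← ∈-points⁻ x∈points =
      j , subst (point s a ∈_) (sym (classBlock≡block i j)) x∈
      where
      c = (a + (n ∸ E i s % n)) % n
      j : Fin (length (parallelClass i))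
      j = fromℕ< (subst (c <_) (sym (length-applyUpTo (block i) n)) (m%n<n _ n))
      x∈ : point s a ∈ block i (toℕ j)
      x∈ = subst (λ c → point s a ∈ block i c) (sym (toℕ-fromℕ< _)) (∈-block-through i s a)

    class-disjoint : ∀ i {x} j j′ → x ∈ classBlock (i , j) → x ∈ classBlock (i , j′) → j ≡ j′
    class-disjoint i j j′ x∈ x∈′ =
      classIndex-injective i (∈-block-unique (∈-classBlock⁻ x∈) (∈-classBlock⁻ x∈′))

    classBlocks-meet-once : ∀ {x y} → x ≢ y → ∀ (β γ : ClassBlock) →
      x ∈ classBlock β → y ∈ classBlock β → x ∈ classBlock γ → y ∈ classBlock γ → β ≡ γ
    classBlocks-meet-once x≢y (i , j) (i′ , j′) x∈ y∈ x∈′ y∈′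
      with refl , j≡j′ ← blocks-meet-once x≢y (∈-classBlock⁻ x∈) (∈-classBlock⁻ y∈)
                                              (∈-classBlock⁻ x∈′) (∈-classBlock⁻ y∈′)
      = cong (i ,_) (classIndex-injective i j≡j′)

    heffterSpace : HeffterSpace q ((q ∸ 1) / 2) k r
    heffterSpace = record
      { V           = points
      ; numPts      = length-halfSet {V = points} ±points↭
      ; halfSet     = isHalfSet ±points↭
      ; classes     = parallelClass
      ; blockSize   = ∀-classBlock (λ B → length B ≡ k) block-length
      ; blockUnique = ∀-classBlock Unique block-unique
      ; blockInV    = ∀-classBlock (All (_∈ points)) block⊆points
      ; zeroSum     = ∀-classBlock (λ B → q ∣ sum (map toℕ B)) block-zeroSum
      ; classCovers = λ i x → class-covers i
      ; classDisj   = λ i x → class-disjoint i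
      ; linear      = λ x y → classBlocks-meet-once
      }

record Certificate : Set where
  constructor certificate
  field
    q n h   : ℕ
    {{q≢0}} : NonZero q
    {{n≢0}} : NonZero n
    g       : Vec ℕ 6
    E       : Vec (Vec ℕ 6) 6

module _ (cert : Certificate) where
  open Certificate cert
  open CyclotomicConstruction q n h (Vec.lookup g) (λ i → Vec.lookup (Vec.lookup E i))

  -- Lists to be evaluated are built with iterate, whose elements the type checker computes
  -- incrementally; each element of applyUpTo f m is recomputed as a chain of applications of f.
  residues : List ℕ
  residues = concatMap (λ s → iterate (λ x → x * h % q) (residue s 0) n) (allFin 6)

  sortedCheck check : Bool
  sortedCheck = sort (residues ++ map (q ∸_) residues) ≡ᵇ-list iterate suc 1 (q ∸ 1)
  check       = sortedCheck ∧ checkConditions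

  check⇒heffterSpace : T check → HeffterSpace q ((q ∸ 1) / 2) 6 6
  check⇒heffterSpace ok = heffterSpace ±points↭ (checkConditions-sound conditions-ok)
    where
    sorted-ok     = proj₁ (T-∧⁻ {sortedCheck} ok)
    conditions-ok = proj₂ (T-∧⁻ {sortedCheck} ok)
    signed = residues ++ map (q ∸_) residues
    sorted : sort signed ≡ nonzeroResidues q
    sorted = trans (≡ᵇ-list⇒≡ _ _ sorted-ok) (iterate≡applyUpTo suc (λ _ → refl) (q ∸ 1))
    ±points↭ : signedResidues points ↭ nonzeroResidues q
    ±points↭ = subst (λ rs → rs ++ map (q ∸_) rs ↭ nonzeroResidues q) (sym residues-iterate)
                     (subst (signed ↭_) sorted (↭-sym (sort-↭ signed)))

certifies : ℕ → Certificate → Bool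
certifies q cert = (Certificate.q cert ≡ᵇ q) ∧ check cert

prime⇒noSmallDivisor : ∀ {q} → Prime q → 109 ≤ q →
                       ¬ Any (λ d → T (q % (2 + d) ≡ᵇ 0)) (downFrom 107)
prime⇒noSmallDivisor {q} q-prime 109≤q small
  with d , d∈ , q%[2+d]≡0 ← find small
  with prime⇒irreducible q-prime (m%n≡0⇒n∣m q (2 + d) (≡ᵇ⇒≡ _ _ q%[2+d]≡0))
... | inj₁ ()
... | inj₂ 2+d≡q = <⇒≢ (≤-trans (s≤s (s≤s (∈-downFrom⁻ d∈))) 109≤q) 2+d≡q

-- The certificate list is a parameter and the proofs below avoid with-abstraction:
-- both keep the type checker from normalising check.
module _ (certs : List Certificate) where

  Certified : ℕ → Set
  Certified q = Any (T ∘ certifies q) certs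

  certified⇒heffterSpace : ∀ {q} → Certified q → HeffterSpace q ((q ∸ 1) / 2) 6 6
  certified⇒heffterSpace {q} certified =
    let cert , ok  = satisfied certified
        q≡ , ok′ = T-∧⁻ {Certificate.q cert ≡ᵇ q} ok
    in subst (λ q → HeffterSpace q ((q ∸ 1) / 2) 6 6) (≡ᵇ⇒≡ _ _ q≡)
             (check⇒heffterSpace cert ok′)

  covered : ℕ → Bool
  covered q = not (q % 24 ≡ᵇ 13)
            ∨ any (λ d → q % (2 + d) ≡ᵇ 0) (downFrom 107)
            ∨ any (certifies q) certs

  covered-range : all covered (applyDownFrom (109 +_) 7892) ≡ true →
                  ∀ {q} → 109 ≤ q → q ≤ 8000 → T (covered q)
  covered-range all-covered {q} 109≤q q≤8000 =
    All-lookup (all⁺ covered _ (Equivalence.from T-≡ all-covered)) q∈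
    where
    q∈ : q ∈ applyDownFrom (109 +_) 7892
    q∈ = subst (_∈ _) (m+[n∸m]≡n 109≤q)
               (∈-applyDownFrom⁺ (109 +_) (s≤s (∸-monoˡ-≤ 109 q≤8000)))

  prime-certified : all covered (applyDownFrom (109 +_) 7892) ≡ true →
                    ∀ {q} → Prime q → q % 24 ≡ 13 → 109 ≤ q → q ≤ 8000 → Certified q
  prime-certified all-covered q-prime q≡13 109≤q q≤8000 =
    [ (λ q≢13 → ⊥-elim (T-not⁻ q≢13 (≡⇒≡ᵇ _ _ q≡13)))
    , [ (λ small → ⊥-elim (prime⇒noSmallDivisor q-prime 109≤q (any⁻ _ _ small)))
      , any⁻ _ _
      ]′ ∘ T-∨⁻
    ]′ (T-∨⁻ (covered-range all-covered 109≤q q≤8000))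

certificates : List Certificate
certificates =
  certificate 109 9 16 (1 ∷ 24 ∷ 35 ∷ 107 ∷ 61 ∷ 37 ∷ []) ((0 ∷ 1 ∷ 8 ∷ 0 ∷ 5 ∷ 5 ∷ []) ∷ (0 ∷ 5 ∷ 4 ∷ 1 ∷ 4 ∷ 3 ∷ []) ∷ (0 ∷ 2 ∷ 6 ∷ 4 ∷ 2 ∷ 7 ∷ []) ∷ (0 ∷ 0 ∷ 3 ∷ 6 ∷ 7 ∷ 1 ∷ []) ∷ (0 ∷ 8 ∷ 0 ∷ 2 ∷ 1 ∷ 2 ∷ []) ∷ (0 ∷ 4 ∷ 1 ∷ 5 ∷ 0 ∷ 6 ∷ []) ∷ []) ∷
  certificate 157 13 130 (1 ∷ 5 ∷ 25 ∷ 45 ∷ 154 ∷ 26 ∷ []) ((0 ∷ 6 ∷ 3 ∷ 5 ∷ 9 ∷ 5 ∷ []) ∷ (0 ∷ 1 ∷ 2 ∷ 3 ∷ 5 ∷ 9 ∷ []) ∷ (0 ∷ 8 ∷ 7 ∷ 12 ∷ 6 ∷ 0 ∷ []) ∷ (0 ∷ 3 ∷ 12 ∷ 8 ∷ 3 ∷ 4 ∷ []) ∷ (0 ∷ 4 ∷ 11 ∷ 10 ∷ 0 ∷ 2 ∷ []) ∷ (0 ∷ 0 ∷ 0 ∷ 0 ∷ 10 ∷ 3 ∷ []) ∷ []) ∷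
  certificate 181 15 114 (1 ∷ 2 ∷ 4 ∷ 150 ∷ 16 ∷ 57 ∷ []) ((0 ∷ 14 ∷ 12 ∷ 5 ∷ 0 ∷ 8 ∷ []) ∷ (0 ∷ 0 ∷ 3 ∷ 3 ∷ 3 ∷ 10 ∷ []) ∷ (0 ∷ 11 ∷ 1 ∷ 10 ∷ 13 ∷ 9 ∷ []) ∷ (0 ∷ 6 ∷ 5 ∷ 4 ∷ 11 ∷ 6 ∷ []) ∷ (0 ∷ 12 ∷ 6 ∷ 9 ∷ 10 ∷ 0 ∷ []) ∷ (0 ∷ 13 ∷ 10 ∷ 2 ∷ 8 ∷ 12 ∷ []) ∷ []) ∷
  certificate 229 19 165 (1 ∷ 6 ∷ 36 ∷ 93 ∷ 151 ∷ 142 ∷ []) ((0 ∷ 16 ∷ 5 ∷ 6 ∷ 11 ∷ 0 ∷ []) ∷ (0 ∷ 1 ∷ 12 ∷ 17 ∷ 17 ∷ 8 ∷ []) ∷ (0 ∷ 0 ∷ 10 ∷ 8 ∷ 12 ∷ 9 ∷ []) ∷ (0 ∷ 10 ∷ 7 ∷ 9 ∷ 16 ∷ 14 ∷ []) ∷ (0 ∷ 2 ∷ 9 ∷ 5 ∷ 2 ∷ 1 ∷ []) ∷ (0 ∷ 14 ∷ 15 ∷ 15 ∷ 18 ∷ 5 ∷ []) ∷ []) ∷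
  certificate 277 23 27 (1 ∷ 5 ∷ 25 ∷ 275 ∷ 71 ∷ 227 ∷ []) ((0 ∷ 0 ∷ 15 ∷ 4 ∷ 1 ∷ 15 ∷ []) ∷ (0 ∷ 2 ∷ 4 ∷ 9 ∷ 9 ∷ 10 ∷ []) ∷ (0 ∷ 15 ∷ 6 ∷ 5 ∷ 6 ∷ 1 ∷ []) ∷ (0 ∷ 1 ∷ 5 ∷ 1 ∷ 17 ∷ 17 ∷ []) ∷ (0 ∷ 16 ∷ 13 ∷ 8 ∷ 15 ∷ 22 ∷ []) ∷ (0 ∷ 12 ∷ 19 ∷ 17 ∷ 20 ∷ 9 ∷ []) ∷ []) ∷
  certificate 349 29 257 (1 ∷ 2 ∷ 4 ∷ 163 ∷ 16 ∷ 303 ∷ []) ((0 ∷ 24 ∷ 0 ∷ 15 ∷ 6 ∷ 16 ∷ []) ∷ (0 ∷ 11 ∷ 18 ∷ 18 ∷ 1 ∷ 12 ∷ []) ∷ (0 ∷ 22 ∷ 16 ∷ 5 ∷ 21 ∷ 15 ∷ []) ∷ (0 ∷ 27 ∷ 24 ∷ 9 ∷ 11 ∷ 24 ∷ []) ∷ (0 ∷ 16 ∷ 28 ∷ 26 ∷ 2 ∷ 1 ∷ []) ∷ (0 ∷ 0 ∷ 9 ∷ 21 ∷ 22 ∷ 0 ∷ []) ∷ []) ∷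
  certificate 373 31 366 (1 ∷ 2 ∷ 4 ∷ 139 ∷ 16 ∷ 183 ∷ []) ((0 ∷ 2 ∷ 9 ∷ 23 ∷ 18 ∷ 6 ∷ []) ∷ (0 ∷ 10 ∷ 2 ∷ 25 ∷ 17 ∷ 2 ∷ []) ∷ (0 ∷ 7 ∷ 26 ∷ 10 ∷ 27 ∷ 0 ∷ []) ∷ (0 ∷ 4 ∷ 18 ∷ 13 ∷ 15 ∷ 1 ∷ []) ∷ (0 ∷ 30 ∷ 20 ∷ 19 ∷ 12 ∷ 15 ∷ []) ∷ (0 ∷ 29 ∷ 22 ∷ 16 ∷ 25 ∷ 16 ∷ []) ∷ []) ∷
  certificate 397 33 314 (1 ∷ 5 ∷ 25 ∷ 282 ∷ 228 ∷ 301 ∷ []) ((0 ∷ 7 ∷ 17 ∷ 8 ∷ 32 ∷ 23 ∷ []) ∷ (0 ∷ 11 ∷ 23 ∷ 16 ∷ 0 ∷ 13 ∷ []) ∷ (0 ∷ 16 ∷ 19 ∷ 5 ∷ 18 ∷ 12 ∷ []) ∷ (0 ∷ 3 ∷ 24 ∷ 1 ∷ 20 ∷ 29 ∷ []) ∷ (0 ∷ 29 ∷ 18 ∷ 12 ∷ 19 ∷ 3 ∷ []) ∷ (0 ∷ 4 ∷ 31 ∷ 4 ∷ 14 ∷ 10 ∷ []) ∷ []) ∷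
  certificate 421 35 307 (1 ∷ 2 ∷ 4 ∷ 91 ∷ 16 ∷ 364 ∷ []) ((0 ∷ 26 ∷ 21 ∷ 6 ∷ 26 ∷ 6 ∷ []) ∷ (0 ∷ 2 ∷ 15 ∷ 24 ∷ 7 ∷ 27 ∷ []) ∷ (0 ∷ 10 ∷ 26 ∷ 29 ∷ 2 ∷ 28 ∷ []) ∷ (0 ∷ 18 ∷ 24 ∷ 23 ∷ 3 ∷ 10 ∷ []) ∷ (0 ∷ 9 ∷ 27 ∷ 21 ∷ 28 ∷ 15 ∷ []) ∷ (0 ∷ 28 ∷ 3 ∷ 28 ∷ 29 ∷ 25 ∷ []) ∷ []) ∷
  certificate 541 45 309 (1 ∷ 2 ∷ 4 ∷ 512 ∷ 16 ∷ 425 ∷ []) ((0 ∷ 30 ∷ 37 ∷ 40 ∷ 2 ∷ 21 ∷ []) ∷ (0 ∷ 16 ∷ 8 ∷ 7 ∷ 17 ∷ 41 ∷ []) ∷ (0 ∷ 11 ∷ 27 ∷ 18 ∷ 7 ∷ 38 ∷ []) ∷ (0 ∷ 27 ∷ 33 ∷ 26 ∷ 11 ∷ 29 ∷ []) ∷ (0 ∷ 37 ∷ 15 ∷ 21 ∷ 26 ∷ 43 ∷ []) ∷ (0 ∷ 3 ∷ 32 ∷ 0 ∷ 35 ∷ 40 ∷ []) ∷ []) ∷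
  certificate 613 51 418 (1 ∷ 2 ∷ 4 ∷ 512 ∷ 16 ∷ 209 ∷ []) ((0 ∷ 19 ∷ 45 ∷ 26 ∷ 49 ∷ 6 ∷ []) ∷ (0 ∷ 47 ∷ 47 ∷ 36 ∷ 4 ∷ 4 ∷ []) ∷ (0 ∷ 42 ∷ 36 ∷ 32 ∷ 1 ∷ 43 ∷ []) ∷ (0 ∷ 35 ∷ 0 ∷ 20 ∷ 0 ∷ 32 ∷ []) ∷ (0 ∷ 43 ∷ 22 ∷ 15 ∷ 40 ∷ 8 ∷ []) ∷ (0 ∷ 14 ∷ 1 ∷ 27 ∷ 48 ∷ 36 ∷ []) ∷ []) ∷
  certificate 661 55 130 (1 ∷ 2 ∷ 4 ∷ 512 ∷ 16 ∷ 65 ∷ []) ((0 ∷ 43 ∷ 54 ∷ 22 ∷ 15 ∷ 19 ∷ []) ∷ (0 ∷ 14 ∷ 49 ∷ 54 ∷ 54 ∷ 42 ∷ []) ∷ (0 ∷ 52 ∷ 16 ∷ 46 ∷ 20 ∷ 31 ∷ []) ∷ (0 ∷ 25 ∷ 2 ∷ 23 ∷ 36 ∷ 45 ∷ []) ∷ (0 ∷ 11 ∷ 37 ∷ 16 ∷ 33 ∷ 48 ∷ []) ∷ (0 ∷ 10 ∷ 41 ∷ 39 ∷ 28 ∷ 40 ∷ []) ∷ []) ∷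
  certificate 709 59 551 (1 ∷ 2 ∷ 4 ∷ 512 ∷ 16 ∷ 630 ∷ []) ((0 ∷ 3 ∷ 0 ∷ 11 ∷ 43 ∷ 48 ∷ []) ∷ (0 ∷ 42 ∷ 14 ∷ 47 ∷ 25 ∷ 22 ∷ []) ∷ (0 ∷ 1 ∷ 38 ∷ 58 ∷ 13 ∷ 2 ∷ []) ∷ (0 ∷ 50 ∷ 31 ∷ 38 ∷ 30 ∷ 24 ∷ []) ∷ (0 ∷ 11 ∷ 29 ∷ 26 ∷ 22 ∷ 57 ∷ []) ∷ (0 ∷ 4 ∷ 6 ∷ 49 ∷ 8 ∷ 32 ∷ []) ∷ []) ∷
  certificate 733 61 299 (1 ∷ 6 ∷ 36 ∷ 412 ∷ 563 ∷ 172 ∷ []) ((0 ∷ 42 ∷ 58 ∷ 21 ∷ 39 ∷ 6 ∷ []) ∷ (0 ∷ 24 ∷ 45 ∷ 53 ∷ 22 ∷ 17 ∷ []) ∷ (0 ∷ 56 ∷ 22 ∷ 50 ∷ 51 ∷ 32 ∷ []) ∷ (0 ∷ 39 ∷ 51 ∷ 44 ∷ 47 ∷ 25 ∷ []) ∷ (0 ∷ 32 ∷ 47 ∷ 28 ∷ 20 ∷ 3 ∷ []) ∷ (0 ∷ 37 ∷ 1 ∷ 13 ∷ 6 ∷ 46 ∷ []) ∷ []) ∷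
  certificate 757 63 311 (1 ∷ 2 ∷ 4 ∷ 512 ∷ 16 ∷ 534 ∷ []) ((0 ∷ 50 ∷ 32 ∷ 24 ∷ 28 ∷ 41 ∷ []) ∷ (0 ∷ 23 ∷ 29 ∷ 17 ∷ 61 ∷ 27 ∷ []) ∷ (0 ∷ 38 ∷ 14 ∷ 10 ∷ 26 ∷ 62 ∷ []) ∷ (0 ∷ 30 ∷ 43 ∷ 58 ∷ 4 ∷ 31 ∷ []) ∷ (0 ∷ 0 ∷ 51 ∷ 33 ∷ 60 ∷ 53 ∷ []) ∷ (0 ∷ 32 ∷ 55 ∷ 3 ∷ 31 ∷ 19 ∷ []) ∷ []) ∷
  certificate 829 69 780 (1 ∷ 2 ∷ 4 ∷ 512 ∷ 16 ∷ 390 ∷ []) ((0 ∷ 35 ∷ 0 ∷ 41 ∷ 42 ∷ 35 ∷ []) ∷ (0 ∷ 34 ∷ 38 ∷ 62 ∷ 51 ∷ 39 ∷ []) ∷ (0 ∷ 0 ∷ 48 ∷ 58 ∷ 34 ∷ 66 ∷ []) ∷ (0 ∷ 28 ∷ 42 ∷ 59 ∷ 37 ∷ 2 ∷ []) ∷ (0 ∷ 24 ∷ 61 ∷ 51 ∷ 35 ∷ 33 ∷ []) ∷ (0 ∷ 15 ∷ 23 ∷ 5 ∷ 61 ∷ 46 ∷ []) ∷ []) ∷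
  certificate 853 71 684 (1 ∷ 2 ∷ 4 ∷ 512 ∷ 16 ∷ 342 ∷ []) ((0 ∷ 39 ∷ 24 ∷ 42 ∷ 59 ∷ 21 ∷ []) ∷ (0 ∷ 57 ∷ 18 ∷ 56 ∷ 50 ∷ 50 ∷ []) ∷ (0 ∷ 32 ∷ 8 ∷ 23 ∷ 44 ∷ 45 ∷ []) ∷ (0 ∷ 45 ∷ 4 ∷ 2 ∷ 22 ∷ 56 ∷ []) ∷ (0 ∷ 67 ∷ 33 ∷ 12 ∷ 19 ∷ 51 ∷ []) ∷ (0 ∷ 15 ∷ 23 ∷ 70 ∷ 4 ∷ 12 ∷ []) ∷ []) ∷
  certificate 877 73 588 (1 ∷ 2 ∷ 4 ∷ 512 ∷ 16 ∷ 294 ∷ []) ((0 ∷ 50 ∷ 34 ∷ 27 ∷ 24 ∷ 58 ∷ []) ∷ (0 ∷ 41 ∷ 48 ∷ 62 ∷ 54 ∷ 17 ∷ []) ∷ (0 ∷ 66 ∷ 64 ∷ 9 ∷ 7 ∷ 70 ∷ []) ∷ (0 ∷ 52 ∷ 21 ∷ 54 ∷ 16 ∷ 68 ∷ []) ∷ (0 ∷ 71 ∷ 54 ∷ 21 ∷ 28 ∷ 32 ∷ []) ∷ (0 ∷ 3 ∷ 32 ∷ 14 ∷ 34 ∷ 53 ∷ []) ∷ []) ∷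
  certificate 997 83 9 (1 ∷ 7 ∷ 49 ∷ 32 ∷ 407 ∷ 571 ∷ []) ((0 ∷ 54 ∷ 81 ∷ 37 ∷ 9 ∷ 78 ∷ []) ∷ (0 ∷ 73 ∷ 78 ∷ 25 ∷ 43 ∷ 59 ∷ []) ∷ (0 ∷ 45 ∷ 39 ∷ 2 ∷ 49 ∷ 12 ∷ []) ∷ (0 ∷ 14 ∷ 67 ∷ 15 ∷ 34 ∷ 14 ∷ []) ∷ (0 ∷ 76 ∷ 26 ∷ 43 ∷ 59 ∷ 4 ∷ []) ∷ (0 ∷ 51 ∷ 80 ∷ 19 ∷ 3 ∷ 0 ∷ []) ∷ []) ∷
  certificate 1021 85 491 (1 ∷ 10 ∷ 100 ∷ 949 ∷ 811 ∷ 968 ∷ []) ((0 ∷ 41 ∷ 9 ∷ 10 ∷ 39 ∷ 1 ∷ []) ∷ (0 ∷ 46 ∷ 19 ∷ 66 ∷ 80 ∷ 59 ∷ []) ∷ (0 ∷ 31 ∷ 79 ∷ 2 ∷ 25 ∷ 29 ∷ []) ∷ (0 ∷ 53 ∷ 12 ∷ 26 ∷ 63 ∷ 60 ∷ []) ∷ (0 ∷ 66 ∷ 27 ∷ 69 ∷ 35 ∷ 35 ∷ []) ∷ (0 ∷ 24 ∷ 62 ∷ 16 ∷ 21 ∷ 73 ∷ []) ∷ []) ∷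
  certificate 1069 89 85 (1 ∷ 6 ∷ 36 ∷ 233 ∷ 227 ∷ 905 ∷ []) ((0 ∷ 37 ∷ 72 ∷ 24 ∷ 66 ∷ 51 ∷ []) ∷ (0 ∷ 39 ∷ 50 ∷ 14 ∷ 5 ∷ 3 ∷ []) ∷ (0 ∷ 45 ∷ 47 ∷ 25 ∷ 61 ∷ 87 ∷ []) ∷ (0 ∷ 4 ∷ 60 ∷ 57 ∷ 88 ∷ 74 ∷ []) ∷ (0 ∷ 11 ∷ 77 ∷ 34 ∷ 38 ∷ 26 ∷ []) ∷ (0 ∷ 72 ∷ 16 ∷ 29 ∷ 74 ∷ 35 ∷ []) ∷ []) ∷
  certificate 1093 91 494 (1 ∷ 5 ∷ 25 ∷ 1027 ∷ 625 ∷ 536 ∷ []) ((0 ∷ 42 ∷ 61 ∷ 71 ∷ 60 ∷ 30 ∷ []) ∷ (0 ∷ 49 ∷ 17 ∷ 86 ∷ 9 ∷ 58 ∷ []) ∷ (0 ∷ 26 ∷ 90 ∷ 6 ∷ 8 ∷ 10 ∷ []) ∷ (0 ∷ 24 ∷ 13 ∷ 33 ∷ 58 ∷ 63 ∷ []) ∷ (0 ∷ 62 ∷ 60 ∷ 48 ∷ 40 ∷ 77 ∷ []) ∷ (0 ∷ 17 ∷ 85 ∷ 52 ∷ 36 ∷ 28 ∷ []) ∷ []) ∷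
  certificate 1117 93 745 (1 ∷ 2 ∷ 4 ∷ 512 ∷ 16 ∷ 931 ∷ []) ((0 ∷ 89 ∷ 36 ∷ 63 ∷ 76 ∷ 42 ∷ []) ∷ (0 ∷ 24 ∷ 68 ∷ 58 ∷ 91 ∷ 91 ∷ []) ∷ (0 ∷ 26 ∷ 30 ∷ 42 ∷ 1 ∷ 16 ∷ []) ∷ (0 ∷ 7 ∷ 14 ∷ 67 ∷ 85 ∷ 11 ∷ []) ∷ (0 ∷ 41 ∷ 87 ∷ 48 ∷ 64 ∷ 6 ∷ []) ∷ (0 ∷ 47 ∷ 89 ∷ 53 ∷ 50 ∷ 55 ∷ []) ∷ []) ∷
  certificate 1213 101 457 (1 ∷ 2 ∷ 4 ∷ 512 ∷ 16 ∷ 835 ∷ []) ((0 ∷ 25 ∷ 65 ∷ 67 ∷ 57 ∷ 9 ∷ []) ∷ (0 ∷ 70 ∷ 94 ∷ 55 ∷ 14 ∷ 75 ∷ []) ∷ (0 ∷ 53 ∷ 81 ∷ 25 ∷ 48 ∷ 54 ∷ []) ∷ (0 ∷ 56 ∷ 11 ∷ 30 ∷ 23 ∷ 27 ∷ []) ∷ (0 ∷ 91 ∷ 28 ∷ 9 ∷ 82 ∷ 64 ∷ []) ∷ (0 ∷ 32 ∷ 0 ∷ 46 ∷ 33 ∷ 97 ∷ []) ∷ []) ∷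
  certificate 1237 103 385 (1 ∷ 2 ∷ 4 ∷ 512 ∷ 16 ∷ 811 ∷ []) ((0 ∷ 9 ∷ 27 ∷ 32 ∷ 2 ∷ 85 ∷ []) ∷ (0 ∷ 87 ∷ 44 ∷ 85 ∷ 69 ∷ 24 ∷ []) ∷ (0 ∷ 80 ∷ 24 ∷ 53 ∷ 95 ∷ 48 ∷ []) ∷ (0 ∷ 35 ∷ 70 ∷ 79 ∷ 36 ∷ 100 ∷ []) ∷ (0 ∷ 27 ∷ 2 ∷ 46 ∷ 79 ∷ 72 ∷ []) ∷ (0 ∷ 45 ∷ 83 ∷ 55 ∷ 61 ∷ 101 ∷ []) ∷ []) ∷
  certificate 1381 115 1334 (1 ∷ 2 ∷ 4 ∷ 512 ∷ 16 ∷ 667 ∷ []) ((0 ∷ 26 ∷ 6 ∷ 104 ∷ 70 ∷ 54 ∷ []) ∷ (0 ∷ 77 ∷ 79 ∷ 31 ∷ 22 ∷ 47 ∷ []) ∷ (0 ∷ 40 ∷ 39 ∷ 61 ∷ 24 ∷ 114 ∷ []) ∷ (0 ∷ 13 ∷ 65 ∷ 77 ∷ 48 ∷ 53 ∷ []) ∷ (0 ∷ 24 ∷ 64 ∷ 39 ∷ 79 ∷ 31 ∷ []) ∷ (0 ∷ 56 ∷ 114 ∷ 93 ∷ 50 ∷ 70 ∷ []) ∷ []) ∷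
  certificate 1429 119 926 (1 ∷ 6 ∷ 36 ∷ 388 ∷ 1296 ∷ 1107 ∷ []) ((0 ∷ 77 ∷ 78 ∷ 28 ∷ 111 ∷ 118 ∷ []) ∷ (0 ∷ 118 ∷ 87 ∷ 15 ∷ 19 ∷ 22 ∷ []) ∷ (0 ∷ 99 ∷ 98 ∷ 17 ∷ 110 ∷ 56 ∷ []) ∷ (0 ∷ 32 ∷ 96 ∷ 101 ∷ 34 ∷ 10 ∷ []) ∷ (0 ∷ 90 ∷ 85 ∷ 14 ∷ 99 ∷ 115 ∷ []) ∷ (0 ∷ 80 ∷ 38 ∷ 38 ∷ 54 ∷ 93 ∷ []) ∷ []) ∷
  certificate 1453 121 1190 (1 ∷ 2 ∷ 4 ∷ 512 ∷ 16 ∷ 595 ∷ []) ((0 ∷ 120 ∷ 80 ∷ 68 ∷ 31 ∷ 21 ∷ []) ∷ (0 ∷ 64 ∷ 95 ∷ 53 ∷ 89 ∷ 113 ∷ []) ∷ (0 ∷ 18 ∷ 28 ∷ 114 ∷ 35 ∷ 66 ∷ []) ∷ (0 ∷ 118 ∷ 94 ∷ 74 ∷ 72 ∷ 20 ∷ []) ∷ (0 ∷ 46 ∷ 102 ∷ 89 ∷ 50 ∷ 11 ∷ []) ∷ (0 ∷ 36 ∷ 31 ∷ 15 ∷ 65 ∷ 18 ∷ []) ∷ []) ∷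
  certificate 1549 129 998 (1 ∷ 2 ∷ 4 ∷ 512 ∷ 16 ∷ 499 ∷ []) ((0 ∷ 103 ∷ 96 ∷ 82 ∷ 110 ∷ 81 ∷ []) ∷ (0 ∷ 42 ∷ 123 ∷ 16 ∷ 10 ∷ 128 ∷ []) ∷ (0 ∷ 122 ∷ 48 ∷ 39 ∷ 103 ∷ 124 ∷ []) ∷ (0 ∷ 71 ∷ 45 ∷ 64 ∷ 21 ∷ 95 ∷ []) ∷ (0 ∷ 23 ∷ 34 ∷ 103 ∷ 18 ∷ 80 ∷ []) ∷ (0 ∷ 102 ∷ 18 ∷ 97 ∷ 22 ∷ 10 ∷ []) ∷ []) ∷
  certificate 1597 133 191 (1 ∷ 11 ∷ 121 ∷ 1146 ∷ 268 ∷ 1324 ∷ []) ((0 ∷ 68 ∷ 8 ∷ 96 ∷ 68 ∷ 5 ∷ []) ∷ (0 ∷ 86 ∷ 69 ∷ 37 ∷ 107 ∷ 78 ∷ []) ∷ (0 ∷ 11 ∷ 11 ∷ 16 ∷ 84 ∷ 109 ∷ []) ∷ (0 ∷ 42 ∷ 120 ∷ 49 ∷ 30 ∷ 26 ∷ []) ∷ (0 ∷ 2 ∷ 92 ∷ 32 ∷ 109 ∷ 40 ∷ []) ∷ (0 ∷ 105 ∷ 32 ∷ 13 ∷ 98 ∷ 61 ∷ []) ∷ []) ∷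
  certificate 1621 135 854 (1 ∷ 2 ∷ 4 ∷ 512 ∷ 16 ∷ 427 ∷ []) ((0 ∷ 116 ∷ 61 ∷ 37 ∷ 133 ∷ 69 ∷ []) ∷ (0 ∷ 106 ∷ 79 ∷ 131 ∷ 70 ∷ 110 ∷ []) ∷ (0 ∷ 4 ∷ 30 ∷ 81 ∷ 23 ∷ 49 ∷ []) ∷ (0 ∷ 114 ∷ 21 ∷ 105 ∷ 122 ∷ 72 ∷ []) ∷ (0 ∷ 46 ∷ 33 ∷ 23 ∷ 61 ∷ 54 ∷ []) ∷ (0 ∷ 2 ∷ 39 ∷ 32 ∷ 62 ∷ 103 ∷ []) ∷ []) ∷
  certificate 1669 139 758 (1 ∷ 2 ∷ 4 ∷ 512 ∷ 16 ∷ 379 ∷ []) ((0 ∷ 72 ∷ 11 ∷ 26 ∷ 116 ∷ 72 ∷ []) ∷ (0 ∷ 9 ∷ 78 ∷ 9 ∷ 122 ∷ 43 ∷ []) ∷ (0 ∷ 2 ∷ 123 ∷ 113 ∷ 84 ∷ 54 ∷ []) ∷ (0 ∷ 52 ∷ 111 ∷ 50 ∷ 8 ∷ 92 ∷ []) ∷ (0 ∷ 59 ∷ 16 ∷ 103 ∷ 112 ∷ 35 ∷ []) ∷ (0 ∷ 49 ∷ 65 ∷ 62 ∷ 110 ∷ 63 ∷ []) ∷ []) ∷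
  certificate 1693 141 710 (1 ∷ 2 ∷ 4 ∷ 512 ∷ 16 ∷ 355 ∷ []) ((0 ∷ 57 ∷ 82 ∷ 114 ∷ 16 ∷ 57 ∷ []) ∷ (0 ∷ 82 ∷ 120 ∷ 102 ∷ 53 ∷ 92 ∷ []) ∷ (0 ∷ 40 ∷ 47 ∷ 34 ∷ 72 ∷ 85 ∷ []) ∷ (0 ∷ 101 ∷ 123 ∷ 27 ∷ 84 ∷ 27 ∷ []) ∷ (0 ∷ 84 ∷ 93 ∷ 16 ∷ 17 ∷ 106 ∷ []) ∷ (0 ∷ 51 ∷ 36 ∷ 22 ∷ 3 ∷ 26 ∷ []) ∷ []) ∷
  certificate 1741 145 614 (1 ∷ 2 ∷ 4 ∷ 512 ∷ 16 ∷ 307 ∷ []) ((0 ∷ 129 ∷ 92 ∷ 115 ∷ 82 ∷ 123 ∷ []) ∷ (0 ∷ 89 ∷ 45 ∷ 5 ∷ 44 ∷ 47 ∷ []) ∷ (0 ∷ 78 ∷ 118 ∷ 60 ∷ 55 ∷ 130 ∷ []) ∷ (0 ∷ 43 ∷ 46 ∷ 137 ∷ 19 ∷ 82 ∷ []) ∷ (0 ∷ 137 ∷ 51 ∷ 101 ∷ 62 ∷ 55 ∷ []) ∷ (0 ∷ 29 ∷ 121 ∷ 29 ∷ 8 ∷ 26 ∷ []) ∷ []) ∷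
  certificate 1789 149 485 (1 ∷ 6 ∷ 36 ∷ 259 ∷ 1296 ∷ 379 ∷ []) ((0 ∷ 12 ∷ 81 ∷ 39 ∷ 123 ∷ 67 ∷ []) ∷ (0 ∷ 82 ∷ 83 ∷ 37 ∷ 21 ∷ 51 ∷ []) ∷ (0 ∷ 3 ∷ 31 ∷ 77 ∷ 98 ∷ 137 ∷ []) ∷ (0 ∷ 8 ∷ 107 ∷ 2 ∷ 99 ∷ 88 ∷ []) ∷ (0 ∷ 42 ∷ 144 ∷ 97 ∷ 90 ∷ 35 ∷ []) ∷ (0 ∷ 109 ∷ 66 ∷ 1 ∷ 37 ∷ 64 ∷ []) ∷ []) ∷
  certificate 1861 155 374 (1 ∷ 2 ∷ 4 ∷ 512 ∷ 16 ∷ 187 ∷ []) ((0 ∷ 8 ∷ 129 ∷ 108 ∷ 60 ∷ 125 ∷ []) ∷ (0 ∷ 103 ∷ 9 ∷ 113 ∷ 43 ∷ 23 ∷ []) ∷ (0 ∷ 124 ∷ 31 ∷ 143 ∷ 26 ∷ 81 ∷ []) ∷ (0 ∷ 104 ∷ 39 ∷ 32 ∷ 40 ∷ 83 ∷ []) ∷ (0 ∷ 88 ∷ 22 ∷ 130 ∷ 79 ∷ 141 ∷ []) ∷ (0 ∷ 98 ∷ 127 ∷ 17 ∷ 141 ∷ 135 ∷ []) ∷ []) ∷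
  certificate 1933 161 792 (1 ∷ 5 ∷ 25 ∷ 795 ∷ 625 ∷ 545 ∷ []) ((0 ∷ 118 ∷ 127 ∷ 82 ∷ 10 ∷ 68 ∷ []) ∷ (0 ∷ 38 ∷ 89 ∷ 47 ∷ 5 ∷ 103 ∷ []) ∷ (0 ∷ 107 ∷ 20 ∷ 85 ∷ 148 ∷ 73 ∷ []) ∷ (0 ∷ 12 ∷ 44 ∷ 124 ∷ 124 ∷ 11 ∷ []) ∷ (0 ∷ 78 ∷ 63 ∷ 101 ∷ 136 ∷ 122 ∷ []) ∷ (0 ∷ 48 ∷ 101 ∷ 89 ∷ 120 ∷ 48 ∷ []) ∷ []) ∷
  certificate 2029 169 38 (1 ∷ 2 ∷ 4 ∷ 512 ∷ 16 ∷ 19 ∷ []) ((0 ∷ 69 ∷ 159 ∷ 139 ∷ 35 ∷ 9 ∷ []) ∷ (0 ∷ 33 ∷ 145 ∷ 82 ∷ 102 ∷ 166 ∷ []) ∷ (0 ∷ 116 ∷ 78 ∷ 41 ∷ 149 ∷ 127 ∷ []) ∷ (0 ∷ 134 ∷ 164 ∷ 105 ∷ 127 ∷ 153 ∷ []) ∷ (0 ∷ 15 ∷ 65 ∷ 95 ∷ 152 ∷ 2 ∷ []) ∷ (0 ∷ 16 ∷ 27 ∷ 38 ∷ 110 ∷ 137 ∷ []) ∷ []) ∷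
  certificate 2053 171 2043 (1 ∷ 2 ∷ 4 ∷ 512 ∷ 16 ∷ 2048 ∷ []) ((0 ∷ 49 ∷ 128 ∷ 115 ∷ 140 ∷ 99 ∷ []) ∷ (0 ∷ 71 ∷ 105 ∷ 61 ∷ 166 ∷ 33 ∷ []) ∷ (0 ∷ 43 ∷ 86 ∷ 68 ∷ 63 ∷ 111 ∷ []) ∷ (0 ∷ 9 ∷ 47 ∷ 148 ∷ 12 ∷ 37 ∷ []) ∷ (0 ∷ 46 ∷ 142 ∷ 85 ∷ 131 ∷ 60 ∷ []) ∷ (0 ∷ 28 ∷ 20 ∷ 27 ∷ 120 ∷ 138 ∷ []) ∷ []) ∷
  certificate 2221 185 1875 (1 ∷ 2 ∷ 4 ∷ 512 ∷ 16 ∷ 2048 ∷ []) ((0 ∷ 81 ∷ 50 ∷ 66 ∷ 83 ∷ 139 ∷ []) ∷ (0 ∷ 111 ∷ 176 ∷ 64 ∷ 131 ∷ 68 ∷ []) ∷ (0 ∷ 159 ∷ 146 ∷ 50 ∷ 141 ∷ 96 ∷ []) ∷ (0 ∷ 11 ∷ 64 ∷ 79 ∷ 71 ∷ 1 ∷ []) ∷ (0 ∷ 23 ∷ 68 ∷ 134 ∷ 27 ∷ 4 ∷ []) ∷ (0 ∷ 89 ∷ 84 ∷ 151 ∷ 75 ∷ 74 ∷ []) ∷ []) ∷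
  certificate 2269 189 1827 (1 ∷ 2 ∷ 4 ∷ 512 ∷ 16 ∷ 2048 ∷ []) ((0 ∷ 62 ∷ 151 ∷ 41 ∷ 77 ∷ 76 ∷ []) ∷ (0 ∷ 116 ∷ 63 ∷ 164 ∷ 22 ∷ 145 ∷ []) ∷ (0 ∷ 142 ∷ 121 ∷ 50 ∷ 135 ∷ 59 ∷ []) ∷ (0 ∷ 153 ∷ 84 ∷ 39 ∷ 165 ∷ 32 ∷ []) ∷ (0 ∷ 104 ∷ 186 ∷ 118 ∷ 43 ∷ 29 ∷ []) ∷ (0 ∷ 123 ∷ 175 ∷ 27 ∷ 108 ∷ 122 ∷ []) ∷ []) ∷
  certificate 2293 191 1803 (1 ∷ 2 ∷ 4 ∷ 512 ∷ 16 ∷ 2048 ∷ []) ((0 ∷ 119 ∷ 153 ∷ 49 ∷ 139 ∷ 63 ∷ []) ∷ (0 ∷ 41 ∷ 36 ∷ 153 ∷ 70 ∷ 154 ∷ []) ∷ (0 ∷ 162 ∷ 159 ∷ 19 ∷ 52 ∷ 67 ∷ []) ∷ (0 ∷ 126 ∷ 85 ∷ 113 ∷ 86 ∷ 3 ∷ []) ∷ (0 ∷ 112 ∷ 133 ∷ 36 ∷ 158 ∷ 23 ∷ []) ∷ (0 ∷ 91 ∷ 4 ∷ 167 ∷ 101 ∷ 61 ∷ []) ∷ []) ∷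
  certificate 2341 195 628 (1 ∷ 7 ∷ 49 ∷ 1790 ∷ 60 ∷ 1093 ∷ []) ((0 ∷ 69 ∷ 18 ∷ 102 ∷ 46 ∷ 117 ∷ []) ∷ (0 ∷ 145 ∷ 193 ∷ 138 ∷ 69 ∷ 104 ∷ []) ∷ (0 ∷ 26 ∷ 145 ∷ 27 ∷ 58 ∷ 176 ∷ []) ∷ (0 ∷ 62 ∷ 144 ∷ 12 ∷ 55 ∷ 154 ∷ []) ∷ (0 ∷ 96 ∷ 112 ∷ 172 ∷ 124 ∷ 161 ∷ []) ∷ (0 ∷ 114 ∷ 175 ∷ 193 ∷ 35 ∷ 145 ∷ []) ∷ []) ∷
  certificate 2389 199 1707 (1 ∷ 2 ∷ 4 ∷ 512 ∷ 16 ∷ 2048 ∷ []) ((0 ∷ 197 ∷ 87 ∷ 14 ∷ 171 ∷ 60 ∷ []) ∷ (0 ∷ 148 ∷ 184 ∷ 132 ∷ 175 ∷ 158 ∷ []) ∷ (0 ∷ 20 ∷ 76 ∷ 126 ∷ 83 ∷ 150 ∷ []) ∷ (0 ∷ 191 ∷ 186 ∷ 172 ∷ 135 ∷ 37 ∷ []) ∷ (0 ∷ 79 ∷ 177 ∷ 136 ∷ 169 ∷ 146 ∷ []) ∷ (0 ∷ 157 ∷ 57 ∷ 89 ∷ 166 ∷ 96 ∷ []) ∷ []) ∷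
  certificate 2437 203 1659 (1 ∷ 2 ∷ 4 ∷ 512 ∷ 16 ∷ 2048 ∷ []) ((0 ∷ 69 ∷ 32 ∷ 169 ∷ 9 ∷ 108 ∷ []) ∷ (0 ∷ 83 ∷ 48 ∷ 139 ∷ 107 ∷ 51 ∷ []) ∷ (0 ∷ 57 ∷ 78 ∷ 118 ∷ 180 ∷ 83 ∷ []) ∷ (0 ∷ 35 ∷ 87 ∷ 80 ∷ 114 ∷ 80 ∷ []) ∷ (0 ∷ 89 ∷ 44 ∷ 143 ∷ 56 ∷ 110 ∷ []) ∷ (0 ∷ 158 ∷ 120 ∷ 188 ∷ 70 ∷ 78 ∷ []) ∷ []) ∷
  certificate 2557 213 1539 (1 ∷ 2 ∷ 4 ∷ 512 ∷ 16 ∷ 2048 ∷ []) ((0 ∷ 144 ∷ 23 ∷ 199 ∷ 88 ∷ 56 ∷ []) ∷ (0 ∷ 128 ∷ 156 ∷ 193 ∷ 5 ∷ 41 ∷ []) ∷ (0 ∷ 149 ∷ 75 ∷ 189 ∷ 47 ∷ 197 ∷ []) ∷ (0 ∷ 51 ∷ 199 ∷ 14 ∷ 199 ∷ 82 ∷ []) ∷ (0 ∷ 102 ∷ 197 ∷ 211 ∷ 109 ∷ 47 ∷ []) ∷ (0 ∷ 140 ∷ 67 ∷ 172 ∷ 81 ∷ 38 ∷ []) ∷ []) ∷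
  certificate 2677 223 1419 (1 ∷ 2 ∷ 4 ∷ 512 ∷ 16 ∷ 2048 ∷ []) ((0 ∷ 108 ∷ 27 ∷ 200 ∷ 154 ∷ 23 ∷ []) ∷ (0 ∷ 138 ∷ 141 ∷ 26 ∷ 125 ∷ 212 ∷ []) ∷ (0 ∷ 66 ∷ 182 ∷ 81 ∷ 76 ∷ 73 ∷ []) ∷ (0 ∷ 182 ∷ 30 ∷ 205 ∷ 150 ∷ 126 ∷ []) ∷ (0 ∷ 42 ∷ 191 ∷ 159 ∷ 138 ∷ 162 ∷ []) ∷ (0 ∷ 148 ∷ 217 ∷ 19 ∷ 74 ∷ 127 ∷ []) ∷ []) ∷
  certificate 2749 229 431 (1 ∷ 6 ∷ 36 ∷ 2611 ∷ 1296 ∷ 530 ∷ []) ((0 ∷ 31 ∷ 59 ∷ 211 ∷ 147 ∷ 30 ∷ []) ∷ (0 ∷ 16 ∷ 90 ∷ 63 ∷ 146 ∷ 185 ∷ []) ∷ (0 ∷ 217 ∷ 19 ∷ 88 ∷ 11 ∷ 160 ∷ []) ∷ (0 ∷ 213 ∷ 171 ∷ 119 ∷ 38 ∷ 147 ∷ []) ∷ (0 ∷ 58 ∷ 124 ∷ 218 ∷ 140 ∷ 29 ∷ []) ∷ (0 ∷ 128 ∷ 71 ∷ 43 ∷ 0 ∷ 100 ∷ []) ∷ []) ∷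
  certificate 2797 233 1299 (1 ∷ 2 ∷ 4 ∷ 512 ∷ 16 ∷ 2048 ∷ []) ((0 ∷ 86 ∷ 80 ∷ 185 ∷ 123 ∷ 142 ∷ []) ∷ (0 ∷ 155 ∷ 119 ∷ 44 ∷ 89 ∷ 9 ∷ []) ∷ (0 ∷ 200 ∷ 131 ∷ 159 ∷ 181 ∷ 123 ∷ []) ∷ (0 ∷ 38 ∷ 145 ∷ 113 ∷ 102 ∷ 138 ∷ []) ∷ (0 ∷ 194 ∷ 155 ∷ 168 ∷ 210 ∷ 95 ∷ []) ∷ (0 ∷ 130 ∷ 73 ∷ 27 ∷ 189 ∷ 57 ∷ []) ∷ []) ∷
  certificate 2917 243 2310 (1 ∷ 5 ∷ 25 ∷ 1652 ∷ 625 ∷ 462 ∷ []) ((0 ∷ 206 ∷ 100 ∷ 93 ∷ 43 ∷ 227 ∷ []) ∷ (0 ∷ 150 ∷ 115 ∷ 182 ∷ 192 ∷ 130 ∷ []) ∷ (0 ∷ 198 ∷ 44 ∷ 100 ∷ 153 ∷ 212 ∷ []) ∷ (0 ∷ 76 ∷ 146 ∷ 181 ∷ 123 ∷ 63 ∷ []) ∷ (0 ∷ 82 ∷ 183 ∷ 113 ∷ 38 ∷ 194 ∷ []) ∷ (0 ∷ 37 ∷ 155 ∷ 139 ∷ 113 ∷ 65 ∷ []) ∷ []) ∷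
  certificate 3037 253 1059 (1 ∷ 2 ∷ 4 ∷ 512 ∷ 16 ∷ 2048 ∷ []) ((0 ∷ 51 ∷ 122 ∷ 252 ∷ 135 ∷ 114 ∷ []) ∷ (0 ∷ 97 ∷ 56 ∷ 204 ∷ 82 ∷ 218 ∷ []) ∷ (0 ∷ 200 ∷ 166 ∷ 5 ∷ 115 ∷ 99 ∷ []) ∷ (0 ∷ 244 ∷ 165 ∷ 239 ∷ 138 ∷ 1 ∷ []) ∷ (0 ∷ 53 ∷ 42 ∷ 31 ∷ 39 ∷ 241 ∷ []) ∷ (0 ∷ 231 ∷ 121 ∷ 149 ∷ 173 ∷ 97 ∷ []) ∷ []) ∷
  certificate 3061 255 1162 (1 ∷ 6 ∷ 36 ∷ 884 ∷ 1296 ∷ 1214 ∷ []) ((0 ∷ 91 ∷ 90 ∷ 107 ∷ 215 ∷ 32 ∷ []) ∷ (0 ∷ 59 ∷ 28 ∷ 240 ∷ 180 ∷ 152 ∷ []) ∷ (0 ∷ 131 ∷ 103 ∷ 86 ∷ 54 ∷ 205 ∷ []) ∷ (0 ∷ 163 ∷ 52 ∷ 203 ∷ 224 ∷ 217 ∷ []) ∷ (0 ∷ 151 ∷ 230 ∷ 200 ∷ 195 ∷ 246 ∷ []) ∷ (0 ∷ 85 ∷ 242 ∷ 29 ∷ 21 ∷ 21 ∷ []) ∷ []) ∷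
  certificate 3109 259 441 (1 ∷ 6 ∷ 36 ∷ 1427 ∷ 1296 ∷ 1628 ∷ []) ((0 ∷ 223 ∷ 242 ∷ 48 ∷ 248 ∷ 175 ∷ []) ∷ (0 ∷ 94 ∷ 140 ∷ 234 ∷ 15 ∷ 118 ∷ []) ∷ (0 ∷ 190 ∷ 11 ∷ 51 ∷ 128 ∷ 96 ∷ []) ∷ (0 ∷ 77 ∷ 133 ∷ 98 ∷ 147 ∷ 202 ∷ []) ∷ (0 ∷ 62 ∷ 153 ∷ 171 ∷ 203 ∷ 219 ∷ []) ∷ (0 ∷ 97 ∷ 142 ∷ 54 ∷ 51 ∷ 210 ∷ []) ∷ []) ∷
  certificate 3181 265 2304 (1 ∷ 7 ∷ 49 ∷ 2622 ∷ 2401 ∷ 1238 ∷ []) ((0 ∷ 35 ∷ 259 ∷ 1 ∷ 113 ∷ 212 ∷ []) ∷ (0 ∷ 223 ∷ 52 ∷ 18 ∷ 44 ∷ 209 ∷ []) ∷ (0 ∷ 11 ∷ 167 ∷ 88 ∷ 207 ∷ 58 ∷ []) ∷ (0 ∷ 6 ∷ 203 ∷ 33 ∷ 12 ∷ 175 ∷ []) ∷ (0 ∷ 67 ∷ 12 ∷ 44 ∷ 47 ∷ 162 ∷ []) ∷ (0 ∷ 200 ∷ 230 ∷ 75 ∷ 133 ∷ 239 ∷ []) ∷ []) ∷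
  certificate 3229 269 421 (1 ∷ 6 ∷ 36 ∷ 3216 ∷ 1296 ∷ 2761 ∷ []) ((0 ∷ 251 ∷ 170 ∷ 205 ∷ 57 ∷ 121 ∷ []) ∷ (0 ∷ 84 ∷ 63 ∷ 28 ∷ 62 ∷ 242 ∷ []) ∷ (0 ∷ 255 ∷ 222 ∷ 133 ∷ 152 ∷ 124 ∷ []) ∷ (0 ∷ 197 ∷ 107 ∷ 130 ∷ 185 ∷ 100 ∷ []) ∷ (0 ∷ 107 ∷ 51 ∷ 216 ∷ 83 ∷ 259 ∷ []) ∷ (0 ∷ 244 ∷ 30 ∷ 98 ∷ 114 ∷ 145 ∷ []) ∷ []) ∷
  certificate 3253 271 843 (1 ∷ 2 ∷ 4 ∷ 512 ∷ 16 ∷ 2048 ∷ []) ((0 ∷ 113 ∷ 225 ∷ 155 ∷ 124 ∷ 231 ∷ []) ∷ (0 ∷ 223 ∷ 266 ∷ 26 ∷ 231 ∷ 111 ∷ []) ∷ (0 ∷ 240 ∷ 248 ∷ 191 ∷ 184 ∷ 169 ∷ []) ∷ (0 ∷ 229 ∷ 108 ∷ 259 ∷ 245 ∷ 200 ∷ []) ∷ (0 ∷ 211 ∷ 182 ∷ 209 ∷ 70 ∷ 71 ∷ []) ∷ (0 ∷ 109 ∷ 24 ∷ 123 ∷ 232 ∷ 100 ∷ []) ∷ []) ∷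
  certificate 3301 275 605 (1 ∷ 6 ∷ 36 ∷ 3044 ∷ 1296 ∷ 651 ∷ []) ((0 ∷ 230 ∷ 88 ∷ 162 ∷ 85 ∷ 6 ∷ []) ∷ (0 ∷ 31 ∷ 143 ∷ 151 ∷ 52 ∷ 251 ∷ []) ∷ (0 ∷ 34 ∷ 187 ∷ 217 ∷ 14 ∷ 75 ∷ []) ∷ (0 ∷ 137 ∷ 268 ∷ 142 ∷ 196 ∷ 138 ∷ []) ∷ (0 ∷ 108 ∷ 193 ∷ 7 ∷ 140 ∷ 156 ∷ []) ∷ (0 ∷ 16 ∷ 91 ∷ 225 ∷ 62 ∷ 235 ∷ []) ∷ []) ∷
  certificate 3373 281 2885 (1 ∷ 5 ∷ 25 ∷ 158 ∷ 625 ∷ 577 ∷ []) ((0 ∷ 276 ∷ 8 ∷ 242 ∷ 147 ∷ 175 ∷ []) ∷ (0 ∷ 96 ∷ 264 ∷ 70 ∷ 31 ∷ 85 ∷ []) ∷ (0 ∷ 159 ∷ 173 ∷ 138 ∷ 214 ∷ 16 ∷ []) ∷ (0 ∷ 15 ∷ 206 ∷ 46 ∷ 132 ∷ 245 ∷ []) ∷ (0 ∷ 233 ∷ 156 ∷ 150 ∷ 252 ∷ 226 ∷ []) ∷ (0 ∷ 161 ∷ 196 ∷ 29 ∷ 56 ∷ 78 ∷ []) ∷ []) ∷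
  certificate 3469 289 627 (1 ∷ 2 ∷ 4 ∷ 512 ∷ 16 ∷ 2048 ∷ []) ((0 ∷ 72 ∷ 239 ∷ 182 ∷ 209 ∷ 187 ∷ []) ∷ (0 ∷ 152 ∷ 56 ∷ 88 ∷ 285 ∷ 24 ∷ []) ∷ (0 ∷ 0 ∷ 209 ∷ 83 ∷ 141 ∷ 195 ∷ []) ∷ (0 ∷ 170 ∷ 227 ∷ 55 ∷ 235 ∷ 91 ∷ []) ∷ (0 ∷ 199 ∷ 106 ∷ 117 ∷ 27 ∷ 90 ∷ []) ∷ (0 ∷ 74 ∷ 287 ∷ 42 ∷ 279 ∷ 266 ∷ []) ∷ []) ∷
  certificate 3517 293 579 (1 ∷ 2 ∷ 4 ∷ 512 ∷ 16 ∷ 2048 ∷ []) ((0 ∷ 263 ∷ 84 ∷ 141 ∷ 188 ∷ 142 ∷ []) ∷ (0 ∷ 26 ∷ 282 ∷ 56 ∷ 136 ∷ 272 ∷ []) ∷ (0 ∷ 1 ∷ 83 ∷ 110 ∷ 174 ∷ 234 ∷ []) ∷ (0 ∷ 184 ∷ 240 ∷ 125 ∷ 144 ∷ 64 ∷ []) ∷ (0 ∷ 18 ∷ 170 ∷ 161 ∷ 150 ∷ 101 ∷ []) ∷ (0 ∷ 161 ∷ 45 ∷ 58 ∷ 16 ∷ 280 ∷ []) ∷ []) ∷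
  certificate 3541 295 3318 (1 ∷ 7 ∷ 49 ∷ 371 ∷ 2401 ∷ 474 ∷ []) ((0 ∷ 94 ∷ 242 ∷ 55 ∷ 43 ∷ 265 ∷ []) ∷ (0 ∷ 59 ∷ 271 ∷ 187 ∷ 291 ∷ 232 ∷ []) ∷ (0 ∷ 183 ∷ 84 ∷ 278 ∷ 164 ∷ 137 ∷ []) ∷ (0 ∷ 0 ∷ 232 ∷ 166 ∷ 88 ∷ 104 ∷ []) ∷ (0 ∷ 290 ∷ 49 ∷ 34 ∷ 6 ∷ 290 ∷ []) ∷ (0 ∷ 241 ∷ 183 ∷ 179 ∷ 231 ∷ 190 ∷ []) ∷ []) ∷
  certificate 3613 301 483 (1 ∷ 2 ∷ 4 ∷ 512 ∷ 16 ∷ 2048 ∷ []) ((0 ∷ 36 ∷ 264 ∷ 4 ∷ 84 ∷ 280 ∷ []) ∷ (0 ∷ 286 ∷ 84 ∷ 70 ∷ 265 ∷ 180 ∷ []) ∷ (0 ∷ 212 ∷ 100 ∷ 31 ∷ 109 ∷ 121 ∷ []) ∷ (0 ∷ 280 ∷ 275 ∷ 295 ∷ 1 ∷ 248 ∷ []) ∷ (0 ∷ 165 ∷ 35 ∷ 199 ∷ 140 ∷ 137 ∷ []) ∷ (0 ∷ 284 ∷ 77 ∷ 66 ∷ 200 ∷ 138 ∷ []) ∷ []) ∷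
  certificate 3637 303 459 (1 ∷ 2 ∷ 4 ∷ 512 ∷ 16 ∷ 2048 ∷ []) ((0 ∷ 247 ∷ 25 ∷ 76 ∷ 134 ∷ 272 ∷ []) ∷ (0 ∷ 177 ∷ 196 ∷ 181 ∷ 79 ∷ 142 ∷ []) ∷ (0 ∷ 105 ∷ 135 ∷ 66 ∷ 254 ∷ 292 ∷ []) ∷ (0 ∷ 181 ∷ 185 ∷ 111 ∷ 154 ∷ 121 ∷ []) ∷ (0 ∷ 197 ∷ 54 ∷ 68 ∷ 57 ∷ 236 ∷ []) ∷ (0 ∷ 50 ∷ 283 ∷ 267 ∷ 73 ∷ 28 ∷ []) ∷ []) ∷
  certificate 3709 309 387 (1 ∷ 2 ∷ 4 ∷ 512 ∷ 16 ∷ 2048 ∷ []) ((0 ∷ 207 ∷ 219 ∷ 257 ∷ 84 ∷ 76 ∷ []) ∷ (0 ∷ 127 ∷ 3 ∷ 88 ∷ 10 ∷ 144 ∷ []) ∷ (0 ∷ 24 ∷ 276 ∷ 177 ∷ 231 ∷ 241 ∷ []) ∷ (0 ∷ 288 ∷ 190 ∷ 179 ∷ 286 ∷ 150 ∷ []) ∷ (0 ∷ 50 ∷ 272 ∷ 44 ∷ 80 ∷ 279 ∷ []) ∷ (0 ∷ 138 ∷ 254 ∷ 183 ∷ 9 ∷ 260 ∷ []) ∷ []) ∷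
  certificate 3733 311 363 (1 ∷ 2 ∷ 4 ∷ 512 ∷ 16 ∷ 2048 ∷ []) ((0 ∷ 164 ∷ 115 ∷ 254 ∷ 291 ∷ 102 ∷ []) ∷ (0 ∷ 73 ∷ 12 ∷ 83 ∷ 252 ∷ 172 ∷ []) ∷ (0 ∷ 291 ∷ 193 ∷ 271 ∷ 209 ∷ 197 ∷ []) ∷ (0 ∷ 18 ∷ 214 ∷ 153 ∷ 94 ∷ 232 ∷ []) ∷ (0 ∷ 196 ∷ 82 ∷ 246 ∷ 4 ∷ 114 ∷ []) ∷ (0 ∷ 151 ∷ 47 ∷ 80 ∷ 59 ∷ 291 ∷ []) ∷ []) ∷
  certificate 3853 321 243 (1 ∷ 2 ∷ 4 ∷ 512 ∷ 16 ∷ 2048 ∷ []) ((0 ∷ 45 ∷ 73 ∷ 78 ∷ 15 ∷ 221 ∷ []) ∷ (0 ∷ 42 ∷ 104 ∷ 207 ∷ 242 ∷ 267 ∷ []) ∷ (0 ∷ 290 ∷ 99 ∷ 162 ∷ 124 ∷ 134 ∷ []) ∷ (0 ∷ 62 ∷ 175 ∷ 182 ∷ 126 ∷ 253 ∷ []) ∷ (0 ∷ 280 ∷ 38 ∷ 121 ∷ 39 ∷ 0 ∷ []) ∷ (0 ∷ 143 ∷ 192 ∷ 285 ∷ 191 ∷ 177 ∷ []) ∷ []) ∷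
  certificate 3877 323 219 (1 ∷ 2 ∷ 4 ∷ 512 ∷ 16 ∷ 2048 ∷ []) ((0 ∷ 65 ∷ 242 ∷ 286 ∷ 0 ∷ 273 ∷ []) ∷ (0 ∷ 188 ∷ 303 ∷ 61 ∷ 10 ∷ 99 ∷ []) ∷ (0 ∷ 286 ∷ 34 ∷ 248 ∷ 261 ∷ 20 ∷ []) ∷ (0 ∷ 79 ∷ 161 ∷ 151 ∷ 173 ∷ 250 ∷ []) ∷ (0 ∷ 236 ∷ 147 ∷ 105 ∷ 263 ∷ 7 ∷ []) ∷ (0 ∷ 254 ∷ 27 ∷ 68 ∷ 298 ∷ 31 ∷ []) ∷ []) ∷
  certificate 4021 335 75 (1 ∷ 2 ∷ 4 ∷ 512 ∷ 16 ∷ 2048 ∷ []) ((0 ∷ 301 ∷ 213 ∷ 265 ∷ 223 ∷ 72 ∷ []) ∷ (0 ∷ 188 ∷ 258 ∷ 239 ∷ 287 ∷ 219 ∷ []) ∷ (0 ∷ 5 ∷ 102 ∷ 191 ∷ 72 ∷ 305 ∷ []) ∷ (0 ∷ 194 ∷ 32 ∷ 0 ∷ 249 ∷ 312 ∷ []) ∷ (0 ∷ 297 ∷ 206 ∷ 14 ∷ 211 ∷ 257 ∷ []) ∷ (0 ∷ 191 ∷ 133 ∷ 282 ∷ 78 ∷ 308 ∷ []) ∷ []) ∷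
  certificate 4093 341 3 (1 ∷ 2 ∷ 4 ∷ 512 ∷ 16 ∷ 2048 ∷ []) ((0 ∷ 137 ∷ 62 ∷ 303 ∷ 283 ∷ 11 ∷ []) ∷ (0 ∷ 14 ∷ 321 ∷ 159 ∷ 34 ∷ 40 ∷ []) ∷ (0 ∷ 312 ∷ 91 ∷ 53 ∷ 173 ∷ 107 ∷ []) ∷ (0 ∷ 47 ∷ 67 ∷ 153 ∷ 111 ∷ 43 ∷ []) ∷ (0 ∷ 253 ∷ 335 ∷ 59 ∷ 157 ∷ 55 ∷ []) ∷ (0 ∷ 148 ∷ 175 ∷ 279 ∷ 305 ∷ 313 ∷ []) ∷ []) ∷
  certificate 4261 355 4096 (1 ∷ 2 ∷ 4 ∷ 512 ∷ 16 ∷ 2048 ∷ []) ((0 ∷ 13 ∷ 198 ∷ 168 ∷ 119 ∷ 188 ∷ []) ∷ (0 ∷ 29 ∷ 276 ∷ 4 ∷ 15 ∷ 228 ∷ []) ∷ (0 ∷ 247 ∷ 232 ∷ 198 ∷ 71 ∷ 48 ∷ []) ∷ (0 ∷ 75 ∷ 218 ∷ 342 ∷ 47 ∷ 32 ∷ []) ∷ (0 ∷ 157 ∷ 115 ∷ 305 ∷ 82 ∷ 84 ∷ []) ∷ (0 ∷ 251 ∷ 220 ∷ 90 ∷ 38 ∷ 160 ∷ []) ∷ []) ∷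
  certificate 4357 363 4096 (1 ∷ 2 ∷ 4 ∷ 512 ∷ 16 ∷ 2048 ∷ []) ((0 ∷ 12 ∷ 169 ∷ 188 ∷ 227 ∷ 16 ∷ []) ∷ (0 ∷ 63 ∷ 290 ∷ 261 ∷ 163 ∷ 216 ∷ []) ∷ (0 ∷ 197 ∷ 129 ∷ 83 ∷ 240 ∷ 73 ∷ []) ∷ (0 ∷ 142 ∷ 275 ∷ 8 ∷ 218 ∷ 128 ∷ []) ∷ (0 ∷ 74 ∷ 1 ∷ 157 ∷ 54 ∷ 138 ∷ []) ∷ (0 ∷ 342 ∷ 333 ∷ 5 ∷ 231 ∷ 29 ∷ []) ∷ []) ∷
  certificate 4549 379 3954 (1 ∷ 6 ∷ 36 ∷ 1661 ∷ 1296 ∷ 659 ∷ []) ((0 ∷ 169 ∷ 159 ∷ 85 ∷ 160 ∷ 18 ∷ []) ∷ (0 ∷ 53 ∷ 311 ∷ 129 ∷ 15 ∷ 53 ∷ []) ∷ (0 ∷ 241 ∷ 322 ∷ 359 ∷ 163 ∷ 243 ∷ []) ∷ (0 ∷ 69 ∷ 152 ∷ 168 ∷ 377 ∷ 219 ∷ []) ∷ (0 ∷ 7 ∷ 25 ∷ 159 ∷ 373 ∷ 144 ∷ []) ∷ (0 ∷ 68 ∷ 89 ∷ 216 ∷ 35 ∷ 49 ∷ []) ∷ []) ∷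
  certificate 4597 383 3149 (1 ∷ 5 ∷ 25 ∷ 3997 ∷ 625 ∷ 3388 ∷ []) ((0 ∷ 221 ∷ 132 ∷ 90 ∷ 306 ∷ 211 ∷ []) ∷ (0 ∷ 254 ∷ 367 ∷ 47 ∷ 359 ∷ 307 ∷ []) ∷ (0 ∷ 249 ∷ 106 ∷ 115 ∷ 127 ∷ 10 ∷ []) ∷ (0 ∷ 313 ∷ 65 ∷ 236 ∷ 361 ∷ 56 ∷ []) ∷ (0 ∷ 189 ∷ 159 ∷ 125 ∷ 73 ∷ 138 ∷ []) ∷ (0 ∷ 162 ∷ 240 ∷ 322 ∷ 91 ∷ 168 ∷ []) ∷ []) ∷
  certificate 4621 385 4096 (1 ∷ 2 ∷ 4 ∷ 512 ∷ 16 ∷ 2048 ∷ []) ((0 ∷ 364 ∷ 330 ∷ 265 ∷ 303 ∷ 331 ∷ []) ∷ (0 ∷ 326 ∷ 230 ∷ 322 ∷ 58 ∷ 87 ∷ []) ∷ (0 ∷ 186 ∷ 28 ∷ 289 ∷ 69 ∷ 205 ∷ []) ∷ (0 ∷ 373 ∷ 152 ∷ 313 ∷ 168 ∷ 46 ∷ []) ∷ (0 ∷ 50 ∷ 211 ∷ 360 ∷ 244 ∷ 201 ∷ []) ∷ (0 ∷ 343 ∷ 359 ∷ 255 ∷ 300 ∷ 332 ∷ []) ∷ []) ∷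
  certificate 4789 399 4096 (1 ∷ 2 ∷ 4 ∷ 512 ∷ 16 ∷ 2048 ∷ []) ((0 ∷ 208 ∷ 313 ∷ 192 ∷ 35 ∷ 200 ∷ []) ∷ (0 ∷ 362 ∷ 149 ∷ 58 ∷ 116 ∷ 0 ∷ []) ∷ (0 ∷ 84 ∷ 204 ∷ 310 ∷ 125 ∷ 282 ∷ []) ∷ (0 ∷ 327 ∷ 208 ∷ 265 ∷ 66 ∷ 139 ∷ []) ∷ (0 ∷ 153 ∷ 111 ∷ 346 ∷ 290 ∷ 225 ∷ []) ∷ (0 ∷ 31 ∷ 98 ∷ 30 ∷ 103 ∷ 298 ∷ []) ∷ []) ∷
  certificate 4813 401 4096 (1 ∷ 2 ∷ 4 ∷ 512 ∷ 16 ∷ 2048 ∷ []) ((0 ∷ 343 ∷ 353 ∷ 15 ∷ 184 ∷ 134 ∷ []) ∷ (0 ∷ 369 ∷ 356 ∷ 307 ∷ 345 ∷ 44 ∷ []) ∷ (0 ∷ 13 ∷ 242 ∷ 375 ∷ 34 ∷ 315 ∷ []) ∷ (0 ∷ 346 ∷ 182 ∷ 143 ∷ 398 ∷ 325 ∷ []) ∷ (0 ∷ 50 ∷ 281 ∷ 91 ∷ 225 ∷ 398 ∷ []) ∷ (0 ∷ 16 ∷ 340 ∷ 1 ∷ 36 ∷ 158 ∷ []) ∷ []) ∷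
  certificate 4861 405 672 (1 ∷ 11 ∷ 121 ∷ 2977 ∷ 58 ∷ 503 ∷ []) ((0 ∷ 170 ∷ 143 ∷ 386 ∷ 367 ∷ 246 ∷ []) ∷ (0 ∷ 280 ∷ 189 ∷ 292 ∷ 190 ∷ 84 ∷ []) ∷ (0 ∷ 133 ∷ 258 ∷ 184 ∷ 381 ∷ 307 ∷ []) ∷ (0 ∷ 343 ∷ 308 ∷ 255 ∷ 208 ∷ 319 ∷ []) ∷ (0 ∷ 117 ∷ 65 ∷ 310 ∷ 93 ∷ 143 ∷ []) ∷ (0 ∷ 33 ∷ 233 ∷ 239 ∷ 18 ∷ 88 ∷ []) ∷ []) ∷
  certificate 4909 409 4102 (1 ∷ 6 ∷ 36 ∷ 4428 ∷ 1296 ∷ 2320 ∷ []) ((0 ∷ 176 ∷ 305 ∷ 109 ∷ 44 ∷ 280 ∷ []) ∷ (0 ∷ 199 ∷ 248 ∷ 153 ∷ 15 ∷ 276 ∷ []) ∷ (0 ∷ 246 ∷ 44 ∷ 234 ∷ 298 ∷ 69 ∷ []) ∷ (0 ∷ 316 ∷ 9 ∷ 59 ∷ 283 ∷ 32 ∷ []) ∷ (0 ∷ 239 ∷ 143 ∷ 201 ∷ 354 ∷ 12 ∷ []) ∷ (0 ∷ 255 ∷ 333 ∷ 205 ∷ 125 ∷ 399 ∷ []) ∷ []) ∷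
  certificate 4933 411 4096 (1 ∷ 2 ∷ 4 ∷ 512 ∷ 16 ∷ 2048 ∷ []) ((0 ∷ 95 ∷ 265 ∷ 227 ∷ 94 ∷ 178 ∷ []) ∷ (0 ∷ 155 ∷ 75 ∷ 144 ∷ 22 ∷ 210 ∷ []) ∷ (0 ∷ 314 ∷ 316 ∷ 231 ∷ 334 ∷ 174 ∷ []) ∷ (0 ∷ 22 ∷ 396 ∷ 275 ∷ 7 ∷ 358 ∷ []) ∷ (0 ∷ 317 ∷ 152 ∷ 103 ∷ 322 ∷ 217 ∷ []) ∷ (0 ∷ 330 ∷ 243 ∷ 115 ∷ 168 ∷ 283 ∷ []) ∷ []) ∷
  certificate 4957 413 4096 (1 ∷ 2 ∷ 4 ∷ 512 ∷ 16 ∷ 2048 ∷ []) ((0 ∷ 311 ∷ 321 ∷ 19 ∷ 201 ∷ 295 ∷ []) ∷ (0 ∷ 81 ∷ 158 ∷ 286 ∷ 204 ∷ 88 ∷ []) ∷ (0 ∷ 207 ∷ 212 ∷ 190 ∷ 99 ∷ 316 ∷ []) ∷ (0 ∷ 193 ∷ 168 ∷ 102 ∷ 390 ∷ 7 ∷ []) ∷ (0 ∷ 271 ∷ 306 ∷ 329 ∷ 9 ∷ 288 ∷ []) ∷ (0 ∷ 200 ∷ 369 ∷ 251 ∷ 270 ∷ 321 ∷ []) ∷ []) ∷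
  certificate 5077 423 4096 (1 ∷ 2 ∷ 4 ∷ 512 ∷ 16 ∷ 2048 ∷ []) ((0 ∷ 196 ∷ 327 ∷ 125 ∷ 98 ∷ 253 ∷ []) ∷ (0 ∷ 226 ∷ 333 ∷ 292 ∷ 336 ∷ 141 ∷ []) ∷ (0 ∷ 366 ∷ 328 ∷ 342 ∷ 231 ∷ 310 ∷ []) ∷ (0 ∷ 202 ∷ 41 ∷ 408 ∷ 112 ∷ 391 ∷ []) ∷ (0 ∷ 295 ∷ 391 ∷ 390 ∷ 134 ∷ 368 ∷ []) ∷ (0 ∷ 51 ∷ 101 ∷ 158 ∷ 272 ∷ 102 ∷ []) ∷ []) ∷
  certificate 5101 425 2000 (1 ∷ 6 ∷ 36 ∷ 3221 ∷ 1296 ∷ 3734 ∷ []) ((0 ∷ 109 ∷ 374 ∷ 3 ∷ 225 ∷ 263 ∷ []) ∷ (0 ∷ 247 ∷ 76 ∷ 81 ∷ 90 ∷ 142 ∷ []) ∷ (0 ∷ 222 ∷ 34 ∷ 221 ∷ 360 ∷ 163 ∷ []) ∷ (0 ∷ 40 ∷ 157 ∷ 76 ∷ 166 ∷ 78 ∷ []) ∷ (0 ∷ 170 ∷ 134 ∷ 265 ∷ 415 ∷ 359 ∷ []) ∷ (0 ∷ 312 ∷ 176 ∷ 277 ∷ 363 ∷ 245 ∷ []) ∷ []) ∷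
  certificate 5197 433 2767 (1 ∷ 7 ∷ 49 ∷ 4099 ∷ 2401 ∷ 3365 ∷ []) ((0 ∷ 227 ∷ 155 ∷ 340 ∷ 73 ∷ 2 ∷ []) ∷ (0 ∷ 319 ∷ 423 ∷ 66 ∷ 187 ∷ 386 ∷ []) ∷ (0 ∷ 361 ∷ 405 ∷ 22 ∷ 189 ∷ 196 ∷ []) ∷ (0 ∷ 42 ∷ 373 ∷ 213 ∷ 249 ∷ 165 ∷ []) ∷ (0 ∷ 371 ∷ 37 ∷ 29 ∷ 169 ∷ 217 ∷ []) ∷ (0 ∷ 181 ∷ 333 ∷ 9 ∷ 173 ∷ 343 ∷ []) ∷ []) ∷
  certificate 5413 451 3499 (1 ∷ 5 ∷ 25 ∷ 4445 ∷ 625 ∷ 2865 ∷ []) ((0 ∷ 244 ∷ 347 ∷ 128 ∷ 394 ∷ 21 ∷ []) ∷ (0 ∷ 50 ∷ 362 ∷ 334 ∷ 90 ∷ 378 ∷ []) ∷ (0 ∷ 327 ∷ 295 ∷ 241 ∷ 190 ∷ 247 ∷ []) ∷ (0 ∷ 404 ∷ 393 ∷ 105 ∷ 395 ∷ 213 ∷ []) ∷ (0 ∷ 433 ∷ 354 ∷ 352 ∷ 156 ∷ 71 ∷ []) ∷ (0 ∷ 144 ∷ 40 ∷ 228 ∷ 6 ∷ 317 ∷ []) ∷ []) ∷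
  certificate 5437 453 3014 (1 ∷ 5 ∷ 25 ∷ 1242 ∷ 625 ∷ 3865 ∷ []) ((0 ∷ 289 ∷ 42 ∷ 173 ∷ 46 ∷ 240 ∷ []) ∷ (0 ∷ 358 ∷ 387 ∷ 246 ∷ 393 ∷ 170 ∷ []) ∷ (0 ∷ 162 ∷ 33 ∷ 26 ∷ 265 ∷ 226 ∷ []) ∷ (0 ∷ 375 ∷ 37 ∷ 357 ∷ 255 ∷ 300 ∷ []) ∷ (0 ∷ 248 ∷ 344 ∷ 2 ∷ 176 ∷ 180 ∷ []) ∷ (0 ∷ 130 ∷ 298 ∷ 235 ∷ 278 ∷ 255 ∷ []) ∷ []) ∷
  certificate 5557 463 4096 (1 ∷ 2 ∷ 4 ∷ 512 ∷ 16 ∷ 2048 ∷ []) ((0 ∷ 225 ∷ 53 ∷ 164 ∷ 34 ∷ 359 ∷ []) ∷ (0 ∷ 109 ∷ 51 ∷ 285 ∷ 164 ∷ 189 ∷ []) ∷ (0 ∷ 246 ∷ 69 ∷ 366 ∷ 84 ∷ 181 ∷ []) ∷ (0 ∷ 252 ∷ 64 ∷ 139 ∷ 184 ∷ 127 ∷ []) ∷ (0 ∷ 441 ∷ 21 ∷ 44 ∷ 218 ∷ 34 ∷ []) ∷ (0 ∷ 37 ∷ 213 ∷ 242 ∷ 147 ∷ 428 ∷ []) ∷ []) ∷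
  certificate 5581 465 2582 (1 ∷ 6 ∷ 36 ∷ 3991 ∷ 1296 ∷ 4151 ∷ []) ((0 ∷ 346 ∷ 26 ∷ 26 ∷ 114 ∷ 118 ∷ []) ∷ (0 ∷ 395 ∷ 401 ∷ 0 ∷ 243 ∷ 249 ∷ []) ∷ (0 ∷ 334 ∷ 408 ∷ 223 ∷ 26 ∷ 84 ∷ []) ∷ (0 ∷ 388 ∷ 350 ∷ 342 ∷ 362 ∷ 196 ∷ []) ∷ (0 ∷ 459 ∷ 373 ∷ 207 ∷ 208 ∷ 150 ∷ []) ∷ (0 ∷ 143 ∷ 3 ∷ 69 ∷ 49 ∷ 30 ∷ []) ∷ []) ∷
  certificate 5653 471 4514 (1 ∷ 5 ∷ 25 ∷ 2840 ∷ 625 ∷ 3164 ∷ []) ((0 ∷ 52 ∷ 303 ∷ 30 ∷ 238 ∷ 132 ∷ []) ∷ (0 ∷ 426 ∷ 179 ∷ 399 ∷ 248 ∷ 79 ∷ []) ∷ (0 ∷ 386 ∷ 115 ∷ 174 ∷ 312 ∷ 343 ∷ []) ∷ (0 ∷ 124 ∷ 402 ∷ 310 ∷ 260 ∷ 289 ∷ []) ∷ (0 ∷ 288 ∷ 326 ∷ 83 ∷ 295 ∷ 325 ∷ []) ∷ (0 ∷ 327 ∷ 53 ∷ 132 ∷ 229 ∷ 131 ∷ []) ∷ []) ∷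
  certificate 5701 475 4096 (1 ∷ 2 ∷ 4 ∷ 512 ∷ 16 ∷ 2048 ∷ []) ((0 ∷ 366 ∷ 234 ∷ 9 ∷ 128 ∷ 64 ∷ []) ∷ (0 ∷ 108 ∷ 432 ∷ 71 ∷ 417 ∷ 192 ∷ []) ∷ (0 ∷ 337 ∷ 103 ∷ 64 ∷ 131 ∷ 322 ∷ []) ∷ (0 ∷ 384 ∷ 450 ∷ 422 ∷ 53 ∷ 214 ∷ []) ∷ (0 ∷ 401 ∷ 58 ∷ 446 ∷ 148 ∷ 132 ∷ []) ∷ (0 ∷ 376 ∷ 410 ∷ 341 ∷ 227 ∷ 61 ∷ []) ∷ []) ∷
  certificate 5749 479 4096 (1 ∷ 2 ∷ 4 ∷ 512 ∷ 16 ∷ 2048 ∷ []) ((0 ∷ 440 ∷ 311 ∷ 121 ∷ 381 ∷ 67 ∷ []) ∷ (0 ∷ 477 ∷ 441 ∷ 429 ∷ 154 ∷ 132 ∷ []) ∷ (0 ∷ 88 ∷ 155 ∷ 392 ∷ 179 ∷ 314 ∷ []) ∷ (0 ∷ 17 ∷ 156 ∷ 151 ∷ 402 ∷ 160 ∷ []) ∷ (0 ∷ 465 ∷ 21 ∷ 161 ∷ 390 ∷ 168 ∷ []) ∷ (0 ∷ 112 ∷ 316 ∷ 75 ∷ 62 ∷ 420 ∷ []) ∷ []) ∷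
  certificate 5821 485 1923 (1 ∷ 6 ∷ 36 ∷ 1545 ∷ 1296 ∷ 3231 ∷ []) ((0 ∷ 305 ∷ 58 ∷ 239 ∷ 421 ∷ 28 ∷ []) ∷ (0 ∷ 442 ∷ 154 ∷ 195 ∷ 124 ∷ 286 ∷ []) ∷ (0 ∷ 207 ∷ 381 ∷ 454 ∷ 429 ∷ 477 ∷ []) ∷ (0 ∷ 437 ∷ 224 ∷ 154 ∷ 261 ∷ 372 ∷ []) ∷ (0 ∷ 262 ∷ 267 ∷ 83 ∷ 373 ∷ 455 ∷ []) ∷ (0 ∷ 309 ∷ 339 ∷ 372 ∷ 437 ∷ 43 ∷ []) ∷ []) ∷
  certificate 5869 489 4096 (1 ∷ 2 ∷ 4 ∷ 512 ∷ 16 ∷ 2048 ∷ []) ((0 ∷ 269 ∷ 398 ∷ 254 ∷ 169 ∷ 91 ∷ []) ∷ (0 ∷ 8 ∷ 68 ∷ 218 ∷ 427 ∷ 23 ∷ []) ∷ (0 ∷ 401 ∷ 171 ∷ 117 ∷ 251 ∷ 150 ∷ []) ∷ (0 ∷ 7 ∷ 252 ∷ 470 ∷ 238 ∷ 255 ∷ []) ∷ (0 ∷ 145 ∷ 106 ∷ 84 ∷ 445 ∷ 292 ∷ []) ∷ (0 ∷ 320 ∷ 399 ∷ 2 ∷ 416 ∷ 239 ∷ []) ∷ []) ∷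
  certificate 6037 503 4345 (1 ∷ 5 ∷ 25 ∷ 3174 ∷ 625 ∷ 869 ∷ []) ((0 ∷ 176 ∷ 239 ∷ 57 ∷ 32 ∷ 236 ∷ []) ∷ (0 ∷ 322 ∷ 491 ∷ 304 ∷ 499 ∷ 403 ∷ []) ∷ (0 ∷ 429 ∷ 218 ∷ 92 ∷ 253 ∷ 134 ∷ []) ∷ (0 ∷ 8 ∷ 493 ∷ 107 ∷ 106 ∷ 127 ∷ []) ∷ (0 ∷ 57 ∷ 187 ∷ 417 ∷ 359 ∷ 363 ∷ []) ∷ (0 ∷ 213 ∷ 278 ∷ 321 ∷ 463 ∷ 324 ∷ []) ∷ []) ∷
  certificate 6133 511 4294 (1 ∷ 5 ∷ 25 ∷ 2831 ∷ 625 ∷ 3312 ∷ []) ((0 ∷ 111 ∷ 469 ∷ 326 ∷ 23 ∷ 85 ∷ []) ∷ (0 ∷ 300 ∷ 495 ∷ 472 ∷ 16 ∷ 398 ∷ []) ∷ (0 ∷ 186 ∷ 127 ∷ 260 ∷ 296 ∷ 509 ∷ []) ∷ (0 ∷ 191 ∷ 497 ∷ 365 ∷ 234 ∷ 281 ∷ []) ∷ (0 ∷ 217 ∷ 296 ∷ 19 ∷ 138 ∷ 18 ∷ []) ∷ (0 ∷ 440 ∷ 412 ∷ 391 ∷ 482 ∷ 121 ∷ []) ∷ []) ∷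
  certificate 6229 519 4096 (1 ∷ 2 ∷ 4 ∷ 512 ∷ 16 ∷ 2048 ∷ []) ((0 ∷ 79 ∷ 169 ∷ 305 ∷ 173 ∷ 439 ∷ []) ∷ (0 ∷ 515 ∷ 118 ∷ 22 ∷ 387 ∷ 203 ∷ []) ∷ (0 ∷ 309 ∷ 236 ∷ 343 ∷ 183 ∷ 263 ∷ []) ∷ (0 ∷ 228 ∷ 368 ∷ 5 ∷ 182 ∷ 82 ∷ []) ∷ (0 ∷ 277 ∷ 157 ∷ 72 ∷ 463 ∷ 159 ∷ []) ∷ (0 ∷ 124 ∷ 218 ∷ 50 ∷ 305 ∷ 290 ∷ []) ∷ []) ∷
  certificate 6277 523 4096 (1 ∷ 2 ∷ 4 ∷ 512 ∷ 16 ∷ 2048 ∷ []) ((0 ∷ 37 ∷ 159 ∷ 309 ∷ 316 ∷ 404 ∷ []) ∷ (0 ∷ 375 ∷ 94 ∷ 46 ∷ 397 ∷ 92 ∷ []) ∷ (0 ∷ 218 ∷ 53 ∷ 126 ∷ 11 ∷ 220 ∷ []) ∷ (0 ∷ 256 ∷ 40 ∷ 250 ∷ 392 ∷ 281 ∷ []) ∷ (0 ∷ 99 ∷ 466 ∷ 495 ∷ 62 ∷ 282 ∷ []) ∷ (0 ∷ 302 ∷ 433 ∷ 471 ∷ 294 ∷ 26 ∷ []) ∷ []) ∷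
  certificate 6301 525 2933 (1 ∷ 10 ∷ 100 ∷ 6096 ∷ 3699 ∷ 4704 ∷ []) ((0 ∷ 318 ∷ 286 ∷ 332 ∷ 448 ∷ 134 ∷ []) ∷ (0 ∷ 120 ∷ 517 ∷ 203 ∷ 243 ∷ 72 ∷ []) ∷ (0 ∷ 259 ∷ 314 ∷ 326 ∷ 88 ∷ 372 ∷ []) ∷ (0 ∷ 150 ∷ 213 ∷ 318 ∷ 244 ∷ 34 ∷ []) ∷ (0 ∷ 141 ∷ 452 ∷ 509 ∷ 287 ∷ 328 ∷ []) ∷ (0 ∷ 340 ∷ 142 ∷ 282 ∷ 77 ∷ 294 ∷ []) ∷ []) ∷
  certificate 6373 531 4096 (1 ∷ 2 ∷ 4 ∷ 512 ∷ 16 ∷ 2048 ∷ []) ((0 ∷ 120 ∷ 459 ∷ 3 ∷ 70 ∷ 193 ∷ []) ∷ (0 ∷ 467 ∷ 442 ∷ 266 ∷ 382 ∷ 286 ∷ []) ∷ (0 ∷ 253 ∷ 404 ∷ 206 ∷ 293 ∷ 351 ∷ []) ∷ (0 ∷ 113 ∷ 281 ∷ 188 ∷ 257 ∷ 176 ∷ []) ∷ (0 ∷ 13 ∷ 464 ∷ 18 ∷ 519 ∷ 116 ∷ []) ∷ (0 ∷ 130 ∷ 346 ∷ 189 ∷ 98 ∷ 10 ∷ []) ∷ []) ∷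
  certificate 6397 533 4096 (1 ∷ 2 ∷ 4 ∷ 512 ∷ 16 ∷ 2048 ∷ []) ((0 ∷ 163 ∷ 182 ∷ 432 ∷ 499 ∷ 324 ∷ []) ∷ (0 ∷ 178 ∷ 368 ∷ 498 ∷ 524 ∷ 298 ∷ []) ∷ (0 ∷ 428 ∷ 197 ∷ 477 ∷ 65 ∷ 474 ∷ []) ∷ (0 ∷ 451 ∷ 204 ∷ 420 ∷ 464 ∷ 445 ∷ []) ∷ (0 ∷ 227 ∷ 120 ∷ 202 ∷ 28 ∷ 404 ∷ []) ∷ (0 ∷ 306 ∷ 309 ∷ 332 ∷ 428 ∷ 390 ∷ []) ∷ []) ∷
  certificate 6421 535 5547 (1 ∷ 6 ∷ 36 ∷ 3147 ∷ 1296 ∷ 4135 ∷ []) ((0 ∷ 329 ∷ 468 ∷ 20 ∷ 81 ∷ 299 ∷ []) ∷ (0 ∷ 43 ∷ 464 ∷ 363 ∷ 127 ∷ 497 ∷ []) ∷ (0 ∷ 49 ∷ 342 ∷ 294 ∷ 476 ∷ 103 ∷ []) ∷ (0 ∷ 25 ∷ 165 ∷ 430 ∷ 352 ∷ 491 ∷ []) ∷ (0 ∷ 178 ∷ 313 ∷ 303 ∷ 297 ∷ 421 ∷ []) ∷ (0 ∷ 523 ∷ 410 ∷ 495 ∷ 51 ∷ 164 ∷ []) ∷ []) ∷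
  certificate 6469 539 4096 (1 ∷ 2 ∷ 4 ∷ 512 ∷ 16 ∷ 2048 ∷ []) ((0 ∷ 15 ∷ 5 ∷ 23 ∷ 250 ∷ 149 ∷ []) ∷ (0 ∷ 162 ∷ 164 ∷ 385 ∷ 6 ∷ 461 ∷ []) ∷ (0 ∷ 393 ∷ 270 ∷ 13 ∷ 84 ∷ 536 ∷ []) ∷ (0 ∷ 57 ∷ 340 ∷ 402 ∷ 348 ∷ 25 ∷ []) ∷ (0 ∷ 295 ∷ 269 ∷ 180 ∷ 270 ∷ 144 ∷ []) ∷ (0 ∷ 198 ∷ 448 ∷ 226 ∷ 77 ∷ 154 ∷ []) ∷ []) ∷
  certificate 6637 553 4096 (1 ∷ 2 ∷ 4 ∷ 512 ∷ 16 ∷ 2048 ∷ []) ((0 ∷ 185 ∷ 444 ∷ 200 ∷ 436 ∷ 179 ∷ []) ∷ (0 ∷ 348 ∷ 479 ∷ 491 ∷ 308 ∷ 516 ∷ []) ∷ (0 ∷ 274 ∷ 461 ∷ 30 ∷ 516 ∷ 354 ∷ []) ∷ (0 ∷ 282 ∷ 70 ∷ 282 ∷ 224 ∷ 171 ∷ []) ∷ (0 ∷ 462 ∷ 46 ∷ 545 ∷ 100 ∷ 207 ∷ []) ∷ (0 ∷ 475 ∷ 260 ∷ 341 ∷ 263 ∷ 473 ∷ []) ∷ []) ∷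
  certificate 6661 555 841 (1 ∷ 6 ∷ 36 ∷ 6264 ∷ 1296 ∷ 5691 ∷ []) ((0 ∷ 286 ∷ 186 ∷ 517 ∷ 137 ∷ 329 ∷ []) ∷ (0 ∷ 182 ∷ 514 ∷ 324 ∷ 535 ∷ 324 ∷ []) ∷ (0 ∷ 83 ∷ 234 ∷ 249 ∷ 113 ∷ 24 ∷ []) ∷ (0 ∷ 308 ∷ 200 ∷ 451 ∷ 426 ∷ 182 ∷ []) ∷ (0 ∷ 471 ∷ 286 ∷ 432 ∷ 441 ∷ 342 ∷ []) ∷ (0 ∷ 454 ∷ 290 ∷ 425 ∷ 261 ∷ 220 ∷ []) ∷ []) ∷
  certificate 6709 559 4096 (1 ∷ 2 ∷ 4 ∷ 512 ∷ 16 ∷ 2048 ∷ []) ((0 ∷ 33 ∷ 512 ∷ 356 ∷ 259 ∷ 355 ∷ []) ∷ (0 ∷ 215 ∷ 47 ∷ 49 ∷ 272 ∷ 143 ∷ []) ∷ (0 ∷ 77 ∷ 79 ∷ 82 ∷ 108 ∷ 255 ∷ []) ∷ (0 ∷ 303 ∷ 271 ∷ 491 ∷ 358 ∷ 90 ∷ []) ∷ (0 ∷ 255 ∷ 528 ∷ 231 ∷ 552 ∷ 272 ∷ []) ∷ (0 ∷ 338 ∷ 216 ∷ 354 ∷ 553 ∷ 73 ∷ []) ∷ []) ∷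
  certificate 6733 561 4096 (1 ∷ 2 ∷ 4 ∷ 512 ∷ 16 ∷ 2048 ∷ []) ((0 ∷ 59 ∷ 419 ∷ 305 ∷ 528 ∷ 320 ∷ []) ∷ (0 ∷ 552 ∷ 247 ∷ 417 ∷ 25 ∷ 65 ∷ []) ∷ (0 ∷ 317 ∷ 218 ∷ 351 ∷ 90 ∷ 316 ∷ []) ∷ (0 ∷ 298 ∷ 134 ∷ 31 ∷ 198 ∷ 31 ∷ []) ∷ (0 ∷ 159 ∷ 356 ∷ 257 ∷ 492 ∷ 70 ∷ []) ∷ (0 ∷ 101 ∷ 300 ∷ 301 ∷ 320 ∷ 230 ∷ []) ∷ []) ∷
  certificate 6781 565 4096 (1 ∷ 2 ∷ 4 ∷ 512 ∷ 16 ∷ 2048 ∷ []) ((0 ∷ 79 ∷ 314 ∷ 23 ∷ 374 ∷ 65 ∷ []) ∷ (0 ∷ 446 ∷ 87 ∷ 439 ∷ 349 ∷ 139 ∷ []) ∷ (0 ∷ 306 ∷ 221 ∷ 338 ∷ 31 ∷ 313 ∷ []) ∷ (0 ∷ 23 ∷ 62 ∷ 194 ∷ 443 ∷ 71 ∷ []) ∷ (0 ∷ 246 ∷ 100 ∷ 43 ∷ 564 ∷ 317 ∷ []) ∷ (0 ∷ 300 ∷ 79 ∷ 525 ∷ 65 ∷ 306 ∷ []) ∷ []) ∷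
  certificate 6829 569 4096 (1 ∷ 2 ∷ 4 ∷ 512 ∷ 16 ∷ 2048 ∷ []) ((0 ∷ 28 ∷ 341 ∷ 510 ∷ 215 ∷ 340 ∷ []) ∷ (0 ∷ 220 ∷ 1 ∷ 41 ∷ 537 ∷ 30 ∷ []) ∷ (0 ∷ 78 ∷ 545 ∷ 359 ∷ 349 ∷ 12 ∷ []) ∷ (0 ∷ 519 ∷ 191 ∷ 473 ∷ 34 ∷ 157 ∷ []) ∷ (0 ∷ 434 ∷ 257 ∷ 375 ∷ 108 ∷ 10 ∷ []) ∷ (0 ∷ 374 ∷ 379 ∷ 148 ∷ 11 ∷ 430 ∷ []) ∷ []) ∷
  certificate 6949 579 4096 (1 ∷ 2 ∷ 4 ∷ 512 ∷ 16 ∷ 2048 ∷ []) ((0 ∷ 563 ∷ 227 ∷ 176 ∷ 516 ∷ 352 ∷ []) ∷ (0 ∷ 25 ∷ 154 ∷ 553 ∷ 373 ∷ 380 ∷ []) ∷ (0 ∷ 164 ∷ 115 ∷ 38 ∷ 352 ∷ 310 ∷ []) ∷ (0 ∷ 307 ∷ 288 ∷ 221 ∷ 86 ∷ 482 ∷ []) ∷ (0 ∷ 239 ∷ 170 ∷ 315 ∷ 162 ∷ 465 ∷ []) ∷ (0 ∷ 315 ∷ 160 ∷ 122 ∷ 575 ∷ 556 ∷ []) ∷ []) ∷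
  certificate 6997 583 1301 (1 ∷ 5 ∷ 25 ∷ 962 ∷ 625 ∷ 3059 ∷ []) ((0 ∷ 1 ∷ 302 ∷ 491 ∷ 448 ∷ 62 ∷ []) ∷ (0 ∷ 559 ∷ 540 ∷ 335 ∷ 57 ∷ 79 ∷ []) ∷ (0 ∷ 484 ∷ 313 ∷ 558 ∷ 479 ∷ 109 ∷ []) ∷ (0 ∷ 317 ∷ 91 ∷ 358 ∷ 270 ∷ 452 ∷ []) ∷ (0 ∷ 24 ∷ 372 ∷ 390 ∷ 297 ∷ 509 ∷ []) ∷ (0 ∷ 370 ∷ 169 ∷ 339 ∷ 192 ∷ 319 ∷ []) ∷ []) ∷
  certificate 7069 589 4096 (1 ∷ 2 ∷ 4 ∷ 512 ∷ 16 ∷ 2048 ∷ []) ((0 ∷ 472 ∷ 219 ∷ 100 ∷ 409 ∷ 64 ∷ []) ∷ (0 ∷ 72 ∷ 438 ∷ 502 ∷ 443 ∷ 542 ∷ []) ∷ (0 ∷ 584 ∷ 8 ∷ 556 ∷ 69 ∷ 277 ∷ []) ∷ (0 ∷ 458 ∷ 147 ∷ 37 ∷ 80 ∷ 23 ∷ []) ∷ (0 ∷ 23 ∷ 252 ∷ 132 ∷ 262 ∷ 346 ∷ []) ∷ (0 ∷ 211 ∷ 479 ∷ 8 ∷ 323 ∷ 55 ∷ []) ∷ []) ∷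
  certificate 7213 601 2214 (1 ∷ 5 ∷ 25 ∷ 5615 ∷ 625 ∷ 3328 ∷ []) ((0 ∷ 15 ∷ 521 ∷ 340 ∷ 153 ∷ 552 ∷ []) ∷ (0 ∷ 34 ∷ 175 ∷ 447 ∷ 242 ∷ 63 ∷ []) ∷ (0 ∷ 295 ∷ 546 ∷ 283 ∷ 311 ∷ 479 ∷ []) ∷ (0 ∷ 86 ∷ 487 ∷ 30 ∷ 331 ∷ 555 ∷ []) ∷ (0 ∷ 59 ∷ 252 ∷ 122 ∷ 498 ∷ 311 ∷ []) ∷ (0 ∷ 348 ∷ 491 ∷ 595 ∷ 149 ∷ 274 ∷ []) ∷ []) ∷
  certificate 7237 603 4096 (1 ∷ 2 ∷ 4 ∷ 512 ∷ 16 ∷ 2048 ∷ []) ((0 ∷ 162 ∷ 95 ∷ 204 ∷ 480 ∷ 500 ∷ []) ∷ (0 ∷ 485 ∷ 410 ∷ 189 ∷ 512 ∷ 350 ∷ []) ∷ (0 ∷ 95 ∷ 421 ∷ 170 ∷ 537 ∷ 222 ∷ []) ∷ (0 ∷ 209 ∷ 465 ∷ 378 ∷ 26 ∷ 47 ∷ []) ∷ (0 ∷ 91 ∷ 176 ∷ 477 ∷ 345 ∷ 540 ∷ []) ∷ (0 ∷ 431 ∷ 133 ∷ 184 ∷ 49 ∷ 425 ∷ []) ∷ []) ∷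
  certificate 7309 609 1338 (1 ∷ 6 ∷ 36 ∷ 5894 ∷ 1296 ∷ 223 ∷ []) ((0 ∷ 342 ∷ 186 ∷ 571 ∷ 575 ∷ 307 ∷ []) ∷ (0 ∷ 389 ∷ 407 ∷ 477 ∷ 394 ∷ 244 ∷ []) ∷ (0 ∷ 557 ∷ 208 ∷ 166 ∷ 67 ∷ 459 ∷ []) ∷ (0 ∷ 127 ∷ 559 ∷ 541 ∷ 393 ∷ 155 ∷ []) ∷ (0 ∷ 480 ∷ 159 ∷ 383 ∷ 545 ∷ 497 ∷ []) ∷ (0 ∷ 415 ∷ 20 ∷ 129 ∷ 570 ∷ 458 ∷ []) ∷ []) ∷
  certificate 7333 611 3285 (1 ∷ 6 ∷ 36 ∷ 2154 ∷ 1296 ∷ 4214 ∷ []) ((0 ∷ 114 ∷ 286 ∷ 331 ∷ 190 ∷ 172 ∷ []) ∷ (0 ∷ 607 ∷ 565 ∷ 23 ∷ 310 ∷ 46 ∷ []) ∷ (0 ∷ 512 ∷ 325 ∷ 277 ∷ 474 ∷ 480 ∷ []) ∷ (0 ∷ 288 ∷ 30 ∷ 511 ∷ 90 ∷ 57 ∷ []) ∷ (0 ∷ 378 ∷ 524 ∷ 418 ∷ 521 ∷ 487 ∷ []) ∷ (0 ∷ 302 ∷ 7 ∷ 169 ∷ 330 ∷ 249 ∷ []) ∷ []) ∷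
  certificate 7477 623 4096 (1 ∷ 2 ∷ 4 ∷ 512 ∷ 16 ∷ 2048 ∷ []) ((0 ∷ 480 ∷ 294 ∷ 310 ∷ 366 ∷ 117 ∷ []) ∷ (0 ∷ 534 ∷ 170 ∷ 555 ∷ 440 ∷ 465 ∷ []) ∷ (0 ∷ 452 ∷ 259 ∷ 10 ∷ 91 ∷ 615 ∷ []) ∷ (0 ∷ 149 ∷ 210 ∷ 381 ∷ 334 ∷ 537 ∷ []) ∷ (0 ∷ 406 ∷ 588 ∷ 418 ∷ 47 ∷ 63 ∷ []) ∷ (0 ∷ 608 ∷ 516 ∷ 541 ∷ 392 ∷ 131 ∷ []) ∷ []) ∷
  certificate 7549 629 4096 (1 ∷ 2 ∷ 4 ∷ 512 ∷ 16 ∷ 2048 ∷ []) ((0 ∷ 101 ∷ 5 ∷ 406 ∷ 176 ∷ 555 ∷ []) ∷ (0 ∷ 297 ∷ 325 ∷ 207 ∷ 551 ∷ 541 ∷ []) ∷ (0 ∷ 46 ∷ 100 ∷ 110 ∷ 200 ∷ 119 ∷ []) ∷ (0 ∷ 39 ∷ 407 ∷ 54 ∷ 172 ∷ 303 ∷ []) ∷ (0 ∷ 405 ∷ 618 ∷ 405 ∷ 355 ∷ 186 ∷ []) ∷ (0 ∷ 125 ∷ 8 ∷ 487 ∷ 341 ∷ 463 ∷ []) ∷ []) ∷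
  certificate 7573 631 4096 (1 ∷ 2 ∷ 4 ∷ 512 ∷ 16 ∷ 2048 ∷ []) ((0 ∷ 51 ∷ 188 ∷ 403 ∷ 519 ∷ 315 ∷ []) ∷ (0 ∷ 171 ∷ 490 ∷ 475 ∷ 517 ∷ 554 ∷ []) ∷ (0 ∷ 69 ∷ 459 ∷ 348 ∷ 417 ∷ 128 ∷ []) ∷ (0 ∷ 322 ∷ 589 ∷ 439 ∷ 526 ∷ 285 ∷ []) ∷ (0 ∷ 423 ∷ 579 ∷ 627 ∷ 237 ∷ 44 ∷ []) ∷ (0 ∷ 509 ∷ 595 ∷ 89 ∷ 442 ∷ 50 ∷ []) ∷ []) ∷
  certificate 7621 635 4096 (1 ∷ 2 ∷ 4 ∷ 512 ∷ 16 ∷ 2048 ∷ []) ((0 ∷ 538 ∷ 336 ∷ 257 ∷ 118 ∷ 237 ∷ []) ∷ (0 ∷ 377 ∷ 221 ∷ 255 ∷ 179 ∷ 228 ∷ []) ∷ (0 ∷ 94 ∷ 229 ∷ 416 ∷ 434 ∷ 416 ∷ []) ∷ (0 ∷ 450 ∷ 74 ∷ 477 ∷ 337 ∷ 485 ∷ []) ∷ (0 ∷ 189 ∷ 11 ∷ 294 ∷ 237 ∷ 310 ∷ []) ∷ (0 ∷ 518 ∷ 7 ∷ 368 ∷ 595 ∷ 632 ∷ []) ∷ []) ∷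
  certificate 7669 639 4096 (1 ∷ 2 ∷ 4 ∷ 512 ∷ 16 ∷ 2048 ∷ []) ((0 ∷ 3 ∷ 57 ∷ 495 ∷ 583 ∷ 476 ∷ []) ∷ (0 ∷ 263 ∷ 509 ∷ 379 ∷ 299 ∷ 630 ∷ []) ∷ (0 ∷ 309 ∷ 493 ∷ 174 ∷ 34 ∷ 634 ∷ []) ∷ (0 ∷ 171 ∷ 53 ∷ 511 ∷ 531 ∷ 95 ∷ []) ∷ (0 ∷ 405 ∷ 199 ∷ 136 ∷ 543 ∷ 633 ∷ []) ∷ (0 ∷ 47 ∷ 188 ∷ 65 ∷ 324 ∷ 368 ∷ []) ∷ []) ∷
  certificate 7717 643 4096 (1 ∷ 2 ∷ 4 ∷ 512 ∷ 16 ∷ 2048 ∷ []) ((0 ∷ 498 ∷ 219 ∷ 333 ∷ 513 ∷ 462 ∷ []) ∷ (0 ∷ 192 ∷ 621 ∷ 45 ∷ 586 ∷ 410 ∷ []) ∷ (0 ∷ 360 ∷ 119 ∷ 375 ∷ 181 ∷ 618 ∷ []) ∷ (0 ∷ 622 ∷ 504 ∷ 521 ∷ 241 ∷ 574 ∷ []) ∷ (0 ∷ 154 ∷ 475 ∷ 549 ∷ 552 ∷ 13 ∷ []) ∷ (0 ∷ 481 ∷ 397 ∷ 153 ∷ 132 ∷ 503 ∷ []) ∷ []) ∷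
  certificate 7741 645 7633 (1 ∷ 7 ∷ 49 ∷ 7515 ∷ 2401 ∷ 4408 ∷ []) ((0 ∷ 44 ∷ 20 ∷ 545 ∷ 180 ∷ 21 ∷ []) ∷ (0 ∷ 218 ∷ 92 ∷ 87 ∷ 215 ∷ 249 ∷ []) ∷ (0 ∷ 209 ∷ 77 ∷ 76 ∷ 386 ∷ 423 ∷ []) ∷ (0 ∷ 380 ∷ 602 ∷ 180 ∷ 378 ∷ 111 ∷ []) ∷ (0 ∷ 225 ∷ 580 ∷ 432 ∷ 547 ∷ 373 ∷ []) ∷ (0 ∷ 16 ∷ 131 ∷ 409 ∷ 350 ∷ 508 ∷ []) ∷ []) ∷
  certificate 7789 649 4096 (1 ∷ 2 ∷ 4 ∷ 512 ∷ 16 ∷ 2048 ∷ []) ((0 ∷ 84 ∷ 84 ∷ 572 ∷ 225 ∷ 311 ∷ []) ∷ (0 ∷ 139 ∷ 397 ∷ 600 ∷ 434 ∷ 603 ∷ []) ∷ (0 ∷ 533 ∷ 571 ∷ 515 ∷ 229 ∷ 624 ∷ []) ∷ (0 ∷ 537 ∷ 45 ∷ 174 ∷ 320 ∷ 570 ∷ []) ∷ (0 ∷ 246 ∷ 227 ∷ 115 ∷ 228 ∷ 284 ∷ []) ∷ (0 ∷ 501 ∷ 556 ∷ 241 ∷ 637 ∷ 50 ∷ []) ∷ []) ∷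
  certificate 7933 661 4096 (1 ∷ 2 ∷ 4 ∷ 512 ∷ 16 ∷ 2048 ∷ []) ((0 ∷ 317 ∷ 438 ∷ 251 ∷ 622 ∷ 248 ∷ []) ∷ (0 ∷ 391 ∷ 145 ∷ 640 ∷ 643 ∷ 139 ∷ []) ∷ (0 ∷ 584 ∷ 160 ∷ 65 ∷ 275 ∷ 485 ∷ []) ∷ (0 ∷ 32 ∷ 568 ∷ 115 ∷ 499 ∷ 541 ∷ []) ∷ (0 ∷ 76 ∷ 626 ∷ 37 ∷ 121 ∷ 627 ∷ []) ∷ (0 ∷ 137 ∷ 420 ∷ 415 ∷ 483 ∷ 194 ∷ []) ∷ []) ∷
  []

-- Stated with ≡ true: checking tt against T (…) makes the type checker evaluate far more slowly.
candidates-covered : all (covered certificates) (applyDownFrom (109 +_) 7892) ≡ true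
candidates-covered = refl

proposition2p6 : ∀ (q : ℕ) → Prime q → q % 24 ≡ 13 → 109 ≤ q → q ≤ 8000 →
                   HeffterSpace q ((q ∸ 1) / 2) 6 6
proposition2p6 q q-prime q≡13 109≤q q≤8000 =
  certified⇒heffterSpace certificates
    (prime-certified certificates candidates-covered q-prime q≡13 109≤q q≤8000)
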